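{- Let $n\ge 2$, $l_1,\dots,l_n,l_\infty\ge 0$. For every $x\in X(l_1,\dots,l_n,l_\infty)$ and every $g\in J_n$, the border thickness of $gx$ equals the border thickness of $x$.
   Context: An arc diagram of type $(l_1,\dots,l_n,l_\infty)$ consists of a circle (the boundary of a closed disc) carrying $n+1$ distinct marked points labelled $z_\infty,z_1,\dots,z_n$ (the labels $z_1,\dots,z_n$ may appear in any order), together with finitely many arcs inside the disc, pairwise non-intersecting except at endpoints, each joining two distinct marked points (several arcs may join the same pair), such that $z_k$ is an endpoint of exactly $l_k$ arcs. Diagrams are considered up to continuous deformation; $X(l_1,\dots,l_n,l_\infty)$ is the set of all of them. Going clockwise from $z_\infty$, the other marked points occupy positions $1,\dots,n$. The cactus group $J_n$ has generators $s_{p,q}$ ($1\le p<q\le n$) and relations $s_{p,q}^2=e$; $s_{p,q}s_{p',q'}=s_{p',q'}s_{p,q}$ if $[p,q]\cap[p',q']=\emptyset$; $s_{p,q}s_{p',q'}s_{p,q}=s_{p+q-q',p+q-p'}$ if $p\le p'<q'\le q$. It acts on $X(l_1,\dots,l_n,l_\infty)$ as follows: for $s_{p,q}$, take a chord $c$ separating the points in positions $p,\dots,q$ from the other marked points (arcs deformed to cross $c$ at most once), reflect the part of the diagram on the side of $c$ not containing $z_\infty$ across the perpendicular bisector of $c$ (reversing the order of the points in positions $p,\dots,q$ and of the crossing points on $c$), and rejoin the arc pieces across $c$. Products act right to left. The border thickness of an arc diagram is the minimum, over the $n+1$ pairs of marked points that are adjacent on the circle, of the number of arcs joining that pair. -}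

module Defs where

open import Data.Nat
open import Data.Nat.Properties using (≤-trans; ≤-reflexive; ∸-monoʳ-≤; m+n∸m≡n; ≤-<-trans; _≤?_)
open import Data.Fin using (Fin; toℕ; fromℕ<)
open import Data.Fin.Properties using (toℕ<n)
import Data.Fin as F
open import Data.Nat.ListAction using (sum)
open import Data.List using (List; []; _∷_; map; upTo; reverse; _++_; concatMap; replicate; zip; foldr)
open import Data.Bool using (Bool; true; false; if_then_else_; _∧_; _xor_)
open import Data.Product using (Σ; _×_; _,_)
open import Data.Sum using (_⊎_)
open import Relation.Nullary using (yes; no)
open import Relation.Binary.PropositionalEquality using (_≡_; _≢_)
open import Function.Definitions using (Injective)

-- Marked points are identified with their positions 0,1,…,n on the circle
-- (position 0 = z∞, positions 1..n clockwise from z∞).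
-- Up to deformation, a diagram is determined by the labelling of the
-- positions and by the number of arcs joining each pair of positions
-- (subject to non-crossing, see InX).

record RawDiagram (n : ℕ) : Set where
  field
    -- position (toℕ k + 1) carries the label z_(toℕ (label k) + 1)
    label : Fin n → Fin n
    -- arcs i j (for i < j) = number of arcs joining positions i and j
    arcs  : ℕ → ℕ → ℕ

open RawDiagram public

mult : ∀ {n} → RawDiagram n → ℕ → ℕ → ℕ
mult x i j = arcs x (i ⊓ j) (i ⊔ j)

deg : ∀ {n} → RawDiagram n → ℕ → ℕ
deg {n} x v = sum (map (λ u → mult x u v) (upTo (suc n)))

-- x is (a representative of) an element of X(l_1,…,l_n,l_∞),
-- where l k = l_(toℕ k + 1).
record InX (n : ℕ) (l : Fin n → ℕ) (l∞ : ℕ) (x : RawDiagram n) : Set where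
  field
    label-bij   : Injective _≡_ _≡_ (label x)   -- (injective on Fin n = bijective)
    support     : ∀ i j → arcs x i j ≢ 0 → i < j × j ≤ n
    noncrossing : ∀ a b c d → a < c → c < b → b < d → arcs x a b ≡ 0 ⊎ arcs x c d ≡ 0
    deg∞        : deg x 0 ≡ l∞
    degk        : ∀ k → deg x (suc (toℕ k)) ≡ l (label x k)

-- Cactus group generators s_{P,Q}, 1 ≤ P < Q ≤ n, given by zero-based
-- indices p q : Fin n with P = toℕ p + 1, Q = toℕ q + 1.

Gen : ℕ → Set
Gen n = Σ (Fin n) λ p → Σ (Fin n) λ q → p F.< q

-- elements of J_n are represented by words in the generators;
-- the word g₁ ∷ g₂ ∷ … ∷ gₖ ∷ [] stands for g₁ g₂ ⋯ gₖ.
Word : ℕ → Set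
Word n = List (Gen n)

inside : ℕ → ℕ → ℕ → Bool
inside P Q v = (P ≤ᵇ v) ∧ (v ≤ᵇ Q)

ρ : ℕ → ℕ → ℕ → ℕ
ρ P Q v = if inside P Q v then P + Q ∸ v else v

private
  refl-bound : ∀ a b k → a ≤ k → a + b ∸ k ≤ b
  refl-bound a b k h = ≤-trans (∸-monoʳ-≤ (a + b) h) (≤-reflexive (m+n∸m≡n a b))

ρFin : ∀ {n} → Fin n → Fin n → Fin n → Fin n
ρFin p q k with toℕ p ≤? toℕ k | toℕ k ≤? toℕ q
... | yes h | yes _ = fromℕ< (≤-<-trans (refl-bound (toℕ p) (toℕ q) (toℕ k) h) (toℕ<n q))
... | _     | _     = k

range : ℕ → ℕ → List ℕ
range a k = map (a +_) (upTo k)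

countPair : ℕ → ℕ → List (ℕ × ℕ) → ℕ
countPair o i xs = sum (map (λ { (a , b) → if (a ≡ᵇ o) ∧ (b ≡ᵇ i) then 1 else 0 }) xs)

actGen : ∀ {n} → Gen n → RawDiagram n → RawDiagram n
actGen {n} (p , q , _) x = record { label = label′ ; arcs = arcs′ }
  where
  P = suc (toℕ p)
  Q = suc (toℕ q)
  ins = inside P Q
  -- number of arcs at v crossing the chord c
  cd : ℕ → ℕ
  cd v = sum (map (λ u → if ins u xor ins v then mult x u v else 0) (upTo (suc n)))
  -- inner points in order along c (from the end between P-1 and P)
  innerSeq : List ℕ
  innerSeq = concatMap (λ v → replicate (cd v) v) (range P (suc (Q ∸ P)))
  -- outer points in the same order: P-1,…,0, n,…,Q+1
  outerSeq : List ℕ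
  outerSeq = concatMap (λ v → replicate (cd v) v)
                       (reverse (upTo P) ++ reverse (range (suc Q) (n ∸ Q)))
  -- crossing arcs after reflecting the inner part (which reverses the
  -- order of the crossing points) and rejoining: (outer , inner)
  newCross : List (ℕ × ℕ)
  newCross = zip outerSeq (reverse (map (ρ P Q) innerSeq))
  newMult : ℕ → ℕ → ℕ
  newMult i j with ins i | ins j
  ... | true  | true  = mult x (ρ P Q i) (ρ P Q j)
  ... | false | false = mult x i j
  ... | true  | false = countPair j i newCross
  ... | false | true  = countPair i j newCross
  arcs′ : ℕ → ℕ → ℕ
  arcs′ i j = if i <ᵇ j then newMult i j else 0
  label′ : Fin n → Fin n
  label′ k = label x (ρFin p q k)

-- products act right to left
act : ∀ {n} → Word n → RawDiagram n → RawDiagram n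
act []      x = x
act (g ∷ w) x = actGen g (act w x)

borderThickness : ∀ {n} → RawDiagram n → ℕ
borderThickness {n} x = foldr _⊓_ (mult x n 0) (map (λ v → mult x v (suc v)) (upTo n))

{-# OPTIONS --safe #-}
-- The proof is an induction on the word that carries non-crossing along.
-- A generator s_{P,Q} keeps the arcs outside the chord, reflects those inside it, and rejoins
-- the arcs crossing it by zipping their outer ends, listed from P - 1 down to 0 and from n down
-- to Q + 1, with their reflected inner ends, listed from P up to Q. Both lists are sorted, so
-- rejoined arcs are nested and the new diagram is again non-crossing. All border pairs except
-- the two at the chord ends, (P - 1, P) and (Q, Q + 1) (cyclically), are merely permuted.
-- Writing c v for the number of arcs at v crossing the chord, the zip joins P - 1 to P at least
-- min (c (P - 1)) (c Q) times and Q to Q + 1 at least min (c (Q + 1)) (c P) times; conversely,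
-- non-crossing forces all crossings at P to end at P - 1 or all crossings at P - 1 to end at P,
-- and likewise at Q. So the smaller of the two chord-end multiplicities is unchanged, and with
-- it the border thickness.
module Submission where

open import Defs
open import Data.Bool using (Bool; true; false; if_then_else_; _∧_; _xor_; T)
open import Data.Bool.Properties using (∧-zeroʳ)
open import Data.Empty using (⊥; ⊥-elim)
open import Data.Fin as Fin using (Fin; toℕ)
open import Data.Fin.Properties using (toℕ<n)
open import Data.List using (List; []; _∷_; map; upTo; downFrom; applyDownFrom; reverse; _++_; concatMap; replicate; zip; foldr; length)
import Data.List.Properties as List
open import Data.List.Membership.Propositional using (_∈_)
open import Data.List.Membership.Propositional.Properties using (∈-++⁻; ∈-map⁻; ∈-upTo⁺; ∈-upTo⁻)
open import Data.List.Relation.Binary.Permutation.Propositional.Properties using (↭-reverse)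
open import Data.List.Relation.Unary.All as All using (All; []; _∷_)
import Data.List.Relation.Unary.All.Properties as All
open import Data.List.Relation.Unary.AllPairs as AllPairs using (AllPairs; []; _∷_)
import Data.List.Relation.Unary.AllPairs.Properties as AllPairs
open import Data.List.Relation.Unary.Any using (here; there)
open import Data.Nat
open import Data.Nat.ListAction using (sum)
open import Data.Nat.ListAction.Properties using (sum-++; sum-↭)
open import Data.Nat.Properties
open import Data.Product using (∃; _×_; _,_; proj₁; proj₂)
open import Data.Sum as Sum using (_⊎_; inj₁; inj₂; [_,_]′; swap)
open import Function using (_∘_; id)
open import Relation.Binary.Definitions using (tri<; tri≈; tri>)
open import Relation.Binary.PropositionalEquality
open import Relation.Nullary using (¬_; yes; no)
open import Relation.Nullary.Decidable using (decidable-stable; dec-true; dec-false; _⊎-dec_)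
open import Relation.Unary using (Decidable)
open import Algebra.Properties.CommutativeSemigroup +-commutativeSemigroup using (interchange; x∙yz≈y∙xz)

<ᵇ-true : ∀ {i j} → i < j → (i <ᵇ j) ≡ true
<ᵇ-true {i} {j} = dec-true (i <? j)

≡ᵇ-refl : ∀ o → (o ≡ᵇ o) ≡ true
≡ᵇ-refl zero    = refl
≡ᵇ-refl (suc o) = ≡ᵇ-refl o

≡ᵇ-≢ : ∀ {a o} → a ≢ o → (a ≡ᵇ o) ≡ false
≡ᵇ-≢ {a} {o} a≢o with a ≡ᵇ o in eq
... | true  = ⊥-elim (a≢o (≡ᵇ⇒≡ a o (subst T (sym eq) _)))
... | false = refl

all⊎all : ∀ {A B : ℕ → Set} → Decidable A → Decidable B → ∀ m →
  (∀ {u w} → u < m → w < m → ¬ A u → ¬ B w → ⊥) →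
  (∀ {u} → u < m → A u) ⊎ (∀ {w} → w < m → B w)
all⊎all A? B? m ¬both with allUpTo? B? m
... | yes allB = inj₂ allB
... | no ¬allB = inj₁ λ u<m → decidable-stable (A? _) λ ¬Au →
  ¬allB λ w<m → decidable-stable (B? _) (¬both u<m w<m ¬Au)

sumBelow : ℕ → (ℕ → ℕ) → ℕ
sumBelow zero    g = 0
sumBelow (suc k) g = g k + sumBelow k g

syntax sumBelow k (λ i → e) = ∑[ i < k ] e

sumBelow-cong : ∀ k {f g : ℕ → ℕ} → (∀ {i} → i < k → f i ≡ g i) → ∑[ i < k ] f i ≡ ∑[ i < k ] g i
sumBelow-cong zero    eq = refl
sumBelow-cong (suc k) eq = cong₂ _+_ (eq ≤-refl) (sumBelow-cong k (eq ∘ m<n⇒m<1+n))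

sumBelow-zero : ∀ k {g : ℕ → ℕ} → (∀ {i} → i < k → g i ≡ 0) → ∑[ i < k ] g i ≡ 0
sumBelow-zero zero    eq = refl
sumBelow-zero (suc k) eq = cong₂ _+_ (eq ≤-refl) (sumBelow-zero k (eq ∘ m<n⇒m<1+n))

sumBelow-distrib-+ : ∀ k (f g : ℕ → ℕ) → ∑[ i < k ] (f i + g i) ≡ ∑[ i < k ] f i + ∑[ i < k ] g i
sumBelow-distrib-+ zero    f g = refl
sumBelow-distrib-+ (suc k) f g =
  trans (cong (f k + g k +_) (sumBelow-distrib-+ k f g)) (interchange (f k) (g k) _ _)

sumBelow-comm : ∀ m k (F : ℕ → ℕ → ℕ) → ∑[ v < k ] ∑[ u < m ] F u v ≡ ∑[ u < m ] ∑[ v < k ] F u v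
sumBelow-comm m zero    F = sym (sumBelow-zero m (λ _ → refl))
sumBelow-comm m (suc k) F =
  trans (cong (∑[ u < m ] F u k +_) (sumBelow-comm m k F))
        (sym (sumBelow-distrib-+ m (λ u → F u k) (λ u → ∑[ v < k ] F u v)))

sumBelow-+ : ∀ a b (g : ℕ → ℕ) → ∑[ i < a + b ] g i ≡ ∑[ i < a ] g i + ∑[ j < b ] g (a + j)
sumBelow-+ a zero    g = trans (cong (λ k → ∑[ i < k ] g i) (+-identityʳ a)) (sym (+-identityʳ _))
sumBelow-+ a (suc b) g = begin
  ∑[ i < a + suc b ] g i                          ≡⟨ cong (λ k → ∑[ i < k ] g i) (+-suc a b) ⟩
  g (a + b) + ∑[ i < a + b ] g i                  ≡⟨ cong (g (a + b) +_) (sumBelow-+ a b g) ⟩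
  g (a + b) + (∑[ i < a ] g i + ∑[ j < b ] g (a + j)) ≡⟨ x∙yz≈y∙xz (g (a + b)) (∑[ i < a ] g i) _ ⟩
  ∑[ i < a ] g i + ∑[ j < suc b ] g (a + j)       ∎
  where open ≡-Reasoning

term≤sumBelow : ∀ (g : ℕ → ℕ) {i k} → i < k → g i ≤ ∑[ j < k ] g j
term≤sumBelow g {i} {suc k} i<1+k with m≤n⇒m<n∨m≡n (s≤s⁻¹ i<1+k)
... | inj₁ i<k  = ≤-trans (term≤sumBelow g i<k) (m≤n+m _ (g k))
... | inj₂ refl = m≤m+n (g i) _

sumBelow-pos : ∀ k (g : ℕ → ℕ) → 0 < ∑[ i < k ] g i → ∃ λ i → i < k × 0 < g i
sumBelow-pos (suc k) g pos with g k in eq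
... | suc _ = k , ≤-refl , subst (0 <_) (sym eq) z<s
... | zero with sumBelow-pos k g pos
...   | i , i<k , gi>0 = i , m<n⇒m<1+n i<k , gi>0

sumBelow≤single : ∀ k (g : ℕ → ℕ) j → (∀ {i} → i < k → g i ≡ 0 ⊎ i ≡ j) → ∑[ i < k ] g i ≤ g j
sumBelow≤single zero    g j only-j = z≤n
sumBelow≤single (suc k) g j only-j with only-j ≤-refl
... | inj₁ gk≡0 = subst (λ z → z + ∑[ i < k ] g i ≤ g j) (sym gk≡0) (sumBelow≤single k g j (only-j ∘ m<n⇒m<1+n))
... | inj₂ refl = ≤-reflexive (trans (cong (g k +_) (sumBelow-zero k vanish)) (+-identityʳ (g k)))
  where
  vanish : ∀ {i} → i < k → g i ≡ 0
  vanish i<k = [ id , (λ { refl → ⊥-elim (<-irrefl refl i<k) }) ]′ (only-j (m<n⇒m<1+n i<k))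

sum-map-applyDownFrom : ∀ k (g f : ℕ → ℕ) → sum (map g (applyDownFrom f k)) ≡ ∑[ i < k ] g (f i)
sum-map-applyDownFrom zero    g f = refl
sum-map-applyDownFrom (suc k) g f = cong (g (f k) +_) (sum-map-applyDownFrom k g f)

sum-map-upTo : ∀ k (g : ℕ → ℕ) → sum (map g (upTo k)) ≡ ∑[ i < k ] g i
sum-map-upTo k g = begin
  sum (map g (upTo k))             ≡⟨ cong (sum ∘ map g) (List.reverse-downFrom k) ⟨
  sum (map g (reverse (downFrom k))) ≡⟨ cong sum (List.reverse-map g (downFrom k)) ⟩
  sum (reverse (map g (downFrom k))) ≡⟨ sum-↭ (↭-reverse (map g (downFrom k))) ⟩
  sum (map g (downFrom k))         ≡⟨ sum-map-applyDownFrom k g id ⟩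
  ∑[ i < k ] g i                   ∎
  where open ≡-Reasoning

replicateEach : (ℕ → ℕ) → List ℕ → List ℕ
replicateEach g = concatMap (λ v → replicate (g v) v)

replicateEach-++ : ∀ g xs ys → replicateEach g (xs ++ ys) ≡ replicateEach g xs ++ replicateEach g ys
replicateEach-++ g []       ys = refl
replicateEach-++ g (x ∷ xs) ys =
  trans (cong (replicate (g x) x ++_) (replicateEach-++ g xs ys)) (sym (List.++-assoc (replicate (g x) x) _ _))

replicateEach-∷ʳ : ∀ g xs w → replicateEach g (xs ++ w ∷ []) ≡ replicateEach g xs ++ replicate (g w) w
replicateEach-∷ʳ g xs w =
  trans (replicateEach-++ g xs (w ∷ [])) (cong (replicateEach g xs ++_) (List.++-identityʳ (replicate (g w) w)))

map-replicateEach-∷ : ∀ (f g : ℕ → ℕ) v ys →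
  map f (replicateEach g (v ∷ ys)) ≡ replicate (g v) (f v) ++ map f (replicateEach g ys)
map-replicateEach-∷ f g v ys =
  trans (List.map-++ f (replicate (g v) v) (replicateEach g ys)) (cong (_++ _) (List.map-replicate f (g v) v))

map-replicateEach-∷ʳ : ∀ (f g : ℕ → ℕ) ys v →
  map f (replicateEach g (ys ++ v ∷ [])) ≡ map f (replicateEach g ys) ++ replicate (g v) (f v)
map-replicateEach-∷ʳ f g ys v = begin
  map f (replicateEach g (ys ++ v ∷ []))              ≡⟨ cong (map f) (replicateEach-∷ʳ g ys v) ⟩
  map f (replicateEach g ys ++ replicate (g v) v)     ≡⟨ List.map-++ f (replicateEach g ys) _ ⟩
  map f (replicateEach g ys) ++ map f (replicate (g v) v) ≡⟨ cong (map f (replicateEach g ys) ++_) (List.map-replicate f (g v) v) ⟩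
  map f (replicateEach g ys) ++ replicate (g v) (f v) ∎
  where open ≡-Reasoning

length-replicateEach : ∀ g xs → length (replicateEach g xs) ≡ sum (map g xs)
length-replicateEach g []       = refl
length-replicateEach g (x ∷ xs) =
  trans (List.length-++ (replicate (g x) x)) (cong₂ _+_ (List.length-replicate (g x)) (length-replicateEach g xs))

∈-replicateEach⁻ : ∀ g xs {w} → w ∈ replicateEach g xs → w ∈ xs × 0 < g w
∈-replicateEach⁻ g (x ∷ xs) w∈ with ∈-++⁻ (replicate (g x) x) w∈
... | inj₂ w∈rest = let w∈xs , gw>0 = ∈-replicateEach⁻ g xs w∈rest in there w∈xs , gw>0
... | inj₁ w∈rep with ∈-replicate⁻ (g x) w∈rep
  where
  ∈-replicate⁻ : ∀ k {w} → w ∈ replicate k x → w ≡ x × 0 < k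
  ∈-replicate⁻ (suc k) (here refl) = refl , z<s
  ∈-replicate⁻ (suc k) (there w∈) = proj₁ (∈-replicate⁻ k w∈) , z<s
...   | refl , gx>0 = here refl , gx>0

replicateEach⁺ : ∀ {P : ℕ → Set} g {xs} → All P xs → All P (replicateEach g xs)
replicateEach⁺ g []         = []
replicateEach⁺ g (px ∷ pxs) = All.++⁺ (All.replicate⁺ (g _) px) (replicateEach⁺ g pxs)

AllPairs-replicateEach : ∀ {R : ℕ → ℕ → Set} g {xs} →
  All (λ v → R v v) xs → AllPairs R xs → AllPairs R (replicateEach g xs)
AllPairs-replicateEach g []         []           = []
AllPairs-replicateEach g (rxx ∷ rs) (rx ∷ rxs) = AllPairs.++⁺
  (AllPairs-replicate (g _) rxx)
  (AllPairs-replicateEach g rs rxs)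
  (All.replicate⁺ (g _) (replicateEach⁺ g rx))
  where
  AllPairs-replicate : ∀ {R : ℕ → ℕ → Set} k {x} → R x x → AllPairs R (replicate k x)
  AllPairs-replicate zero    rxx = []
  AllPairs-replicate (suc k) rxx = All.replicate⁺ k rxx ∷ AllPairs-replicate k rxx

reverse-replicate : ∀ {A : Set} k (x : A) → reverse (replicate k x) ≡ replicate k x
reverse-replicate zero    x = refl
reverse-replicate (suc k) x = begin
  reverse (x ∷ replicate k x)       ≡⟨ List.unfold-reverse x (replicate k x) ⟩
  reverse (replicate k x) ++ x ∷ [] ≡⟨ cong (_++ x ∷ []) (reverse-replicate k x) ⟩
  replicate k x ++ x ∷ []           ≡⟨ replicate-∷ʳ k ⟩
  x ∷ replicate k x                ∎
  where
  open ≡-Reasoning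
  replicate-∷ʳ : ∀ k → replicate k x ++ x ∷ [] ≡ x ∷ replicate k x
  replicate-∷ʳ zero    = refl
  replicate-∷ʳ (suc k) = cong (x ∷_) (replicate-∷ʳ k)

reverse-replicateEach : ∀ g xs → reverse (replicateEach g xs) ≡ replicateEach g (reverse xs)
reverse-replicateEach g []       = refl
reverse-replicateEach g (x ∷ xs) = begin
  reverse (replicate (g x) x ++ replicateEach g xs)          ≡⟨ List.reverse-++ (replicate (g x) x) _ ⟩
  reverse (replicateEach g xs) ++ reverse (replicate (g x) x) ≡⟨ cong₂ _++_ (reverse-replicateEach g xs) (reverse-replicate (g x) x) ⟩
  replicateEach g (reverse xs) ++ replicate (g x) x          ≡⟨ replicateEach-∷ʳ g (reverse xs) x ⟨
  replicateEach g (reverse xs ++ x ∷ [])                      ≡⟨ cong (replicateEach g) (List.unfold-reverse x xs) ⟨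
  replicateEach g (reverse (x ∷ xs))                          ∎
  where open ≡-Reasoning

count : ℕ → List ℕ → ℕ
count o []       = 0
count o (a ∷ xs) = (if a ≡ᵇ o then 1 else 0) + count o xs

count-++ : ∀ o xs ys → count o (xs ++ ys) ≡ count o xs + count o ys
count-++ o []       ys = refl
count-++ o (a ∷ xs) ys = trans (cong (_ +_) (count-++ o xs ys)) (sym (+-assoc (if a ≡ᵇ o then 1 else 0) _ _))

count-replicate : ∀ o k → count o (replicate k o) ≡ k
count-replicate o zero    = refl
count-replicate o (suc k) rewrite ≡ᵇ-refl o = cong suc (count-replicate o k)

count-∉ : ∀ o {xs} → All (_≢ o) xs → count o xs ≡ 0
count-∉ o []              = refl
count-∉ o (a≢o ∷ xs≢o) rewrite ≡ᵇ-≢ a≢o = count-∉ o xs≢o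

count-replicate-++ : ∀ o k {xs} → All (_≢ o) xs → count o (replicate k o ++ xs) ≡ k
count-replicate-++ o k {xs} xs≢o =
  trans (count-++ o (replicate k o) xs) (trans (cong₂ _+_ (count-replicate o k) (count-∉ o xs≢o)) (+-identityʳ k))

count-++-replicate : ∀ o k {xs} → All (_≢ o) xs → count o (xs ++ replicate k o) ≡ k
count-++-replicate o k {xs} xs≢o =
  trans (count-++ o xs (replicate k o)) (cong₂ _+_ (count-∉ o xs≢o) (count-replicate o k))

countPair-zip≤countˡ : ∀ o i xs ys → countPair o i (zip xs ys) ≤ count o xs
countPair-zip≤countˡ o i []       ys       = z≤n
countPair-zip≤countˡ o i (x ∷ xs) []       = z≤n
countPair-zip≤countˡ o i (x ∷ xs) (y ∷ ys) = +-mono-≤ (ind-∧ (x ≡ᵇ o) (y ≡ᵇ i)) (countPair-zip≤countˡ o i xs ys)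
  where
  ind-∧ : ∀ b c → (if b ∧ c then 1 else 0) ≤ (if b then 1 else 0)
  ind-∧ false c     = z≤n
  ind-∧ true  false = z≤n
  ind-∧ true  true  = ≤-refl

countPair-zip≤countʳ : ∀ o i xs ys → countPair o i (zip xs ys) ≤ count i ys
countPair-zip≤countʳ o i []       ys       = z≤n
countPair-zip≤countʳ o i (x ∷ xs) []       = z≤n
countPair-zip≤countʳ o i (x ∷ xs) (y ∷ ys) = +-mono-≤ (ind-∧ (x ≡ᵇ o) (y ≡ᵇ i)) (countPair-zip≤countʳ o i xs ys)
  where
  ind-∧ : ∀ b c → (if b ∧ c then 1 else 0) ≤ (if c then 1 else 0)
  ind-∧ false false = z≤n
  ind-∧ false true  = z≤n
  ind-∧ true  c     = ≤-refl

countPair-zip-∷ : ∀ o i x y xs ys → countPair o i (zip xs ys) ≤ countPair o i (zip (x ∷ xs) (y ∷ ys))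
countPair-zip-∷ o i x y xs ys = m≤n+m _ (if (x ≡ᵇ o) ∧ (y ≡ᵇ i) then 1 else 0)

countPair-zip-replicate-++ : ∀ o i a b xs ys →
  a ⊓ b ≤ countPair o i (zip (replicate a o ++ xs) (replicate b i ++ ys))
countPair-zip-replicate-++ o i zero    b       xs ys = z≤n
countPair-zip-replicate-++ o i (suc a) zero    xs ys = z≤n
countPair-zip-replicate-++ o i (suc a) (suc b) xs ys rewrite ≡ᵇ-refl o | ≡ᵇ-refl i =
  s≤s (countPair-zip-replicate-++ o i a b xs ys)

countPair-zip-replicate : ∀ o i a → a ≤ countPair o i (zip (replicate a o) (replicate a i))
countPair-zip-replicate o i a = subst₂ _≤_ (⊓-idem a)
  (cong₂ (λ xs ys → countPair o i (zip xs ys)) (List.++-identityʳ (replicate a o)) (List.++-identityʳ (replicate a i)))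
  (countPair-zip-replicate-++ o i a a [] [])

countPair-zip-++-replicate : ∀ o i a b xs ys → length xs + a ≡ length ys + b →
  a ⊓ b ≤ countPair o i (zip (xs ++ replicate a o) (ys ++ replicate b i))
countPair-zip-++-replicate o i a b []       ys       eq = ≤-trans (m⊓n≤n a b) (padded-left a ys eq)
  where
  padded-left : ∀ a ys → a ≡ length ys + b → b ≤ countPair o i (zip (replicate a o) (ys ++ replicate b i))
  padded-left a       []       refl = countPair-zip-replicate o i a
  padded-left (suc a) (y ∷ ys) eq   =
    ≤-trans (padded-left a ys (suc-injective eq)) (countPair-zip-∷ o i o y (replicate a o) (ys ++ replicate b i))
countPair-zip-++-replicate o i a b (x ∷ xs) []       eq = ≤-trans (m⊓n≤m a b) (padded-right b (x ∷ xs) eq)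
  where
  padded-right : ∀ b xs → length xs + a ≡ b → a ≤ countPair o i (zip (xs ++ replicate a o) (replicate b i))
  padded-right b       []       refl = countPair-zip-replicate o i a
  padded-right (suc b) (x ∷ xs) eq   =
    ≤-trans (padded-right b xs (suc-injective eq)) (countPair-zip-∷ o i x i (xs ++ replicate a o) (replicate b i))
countPair-zip-++-replicate o i a b (x ∷ xs) (y ∷ ys) eq =
  ≤-trans (countPair-zip-++-replicate o i a b xs ys (suc-injective eq))
          (countPair-zip-∷ o i x y (xs ++ replicate a o) (ys ++ replicate b i))

countPair-pos : ∀ o i zs → 0 < countPair o i zs → (o , i) ∈ zs
countPair-pos o i ((a , b) ∷ zs) pos with a ≡ᵇ o in a≡o | b ≡ᵇ i in b≡i
... | true  | true  = here (cong₂ _,_ (sym (≡ᵇ⇒≡ a o (subst T (sym a≡o) _))) (sym (≡ᵇ⇒≡ b i (subst T (sym b≡i) _))))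
... | true  | false = there (countPair-pos o i zs pos)
... | false | _     = there (countPair-pos o i zs pos)

∈-zip⁻ : ∀ {a b : ℕ} xs ys → (a , b) ∈ zip xs ys → a ∈ xs × b ∈ ys
∈-zip⁻ (x ∷ xs) (y ∷ ys) (here refl) = here refl , here refl
∈-zip⁻ (x ∷ xs) (y ∷ ys) (there ab∈) = let a∈ , b∈ = ∈-zip⁻ xs ys ab∈ in there a∈ , there b∈

_⟨×⟩_ : (ℕ → ℕ → Set) → (ℕ → ℕ → Set) → ℕ × ℕ → ℕ × ℕ → Set
(R ⟨×⟩ S) (a , b) (c , d) = R a c × S b d

module _ {R S : ℕ → ℕ → Set} where

  All-zip : ∀ {x y xs ys} → All (R x) xs → All (S y) ys → All ((R ⟨×⟩ S) (x , y)) (zip xs ys)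
  All-zip []       _        = []
  All-zip (_ ∷ _)  []       = []
  All-zip (r ∷ rs) (s ∷ ss) = (r , s) ∷ All-zip rs ss

  AllPairs-zip : ∀ {xs ys} → AllPairs R xs → AllPairs S ys → AllPairs (R ⟨×⟩ S) (zip xs ys)
  AllPairs-zip []         _          = []
  AllPairs-zip (_ ∷ _)    []         = []
  AllPairs-zip (rx ∷ rxs) (sy ∷ sys) = All-zip rx sy ∷ AllPairs-zip rxs sys

AllPairs-∈ : ∀ {A : Set} {R : A → A → Set} {xs a b} → AllPairs R xs → a ∈ xs → b ∈ xs → R a b ⊎ R b a ⊎ a ≡ b
AllPairs-∈ (r ∷ rs) (here refl) (here refl) = inj₂ (inj₂ refl)
AllPairs-∈ (r ∷ rs) (here refl) (there b∈)  = inj₁ (All.lookup r b∈)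
AllPairs-∈ (r ∷ rs) (there a∈)  (here refl) = inj₂ (inj₁ (All.lookup r a∈))
AllPairs-∈ (r ∷ rs) (there a∈)  (there b∈)  = AllPairs-∈ rs a∈ b∈

-- Non-crossing diagrams

module _ {n} (z : RawDiagram n) where

  mult-comm : ∀ a b → mult z a b ≡ mult z b a
  mult-comm a b = cong₂ (arcs z) (⊓-comm a b) (⊔-comm a b)

  mult-< : ∀ {a b} → a < b → mult z a b ≡ arcs z a b
  mult-< a<b = cong₂ (arcs z) (m≤n⇒m⊓n≡m (<⇒≤ a<b)) (m≤n⇒m⊔n≡n (<⇒≤ a<b))

  mult-> : ∀ {a b} → a < b → mult z b a ≡ arcs z a b
  mult-> {a} {b} a<b = trans (mult-comm b a) (mult-< a<b)

  mult-pos-comm : ∀ {a b} → 0 < mult z a b → 0 < mult z b a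
  mult-pos-comm {a} {b} = subst (0 <_) (mult-comm a b)

NonCrossing : ∀ {n} → RawDiagram n → Set
NonCrossing z = ∀ a b c d → a < c → c < b → b < d → arcs z a b ≡ 0 ⊎ arcs z c d ≡ 0

¬crossing : ∀ {n} (z : RawDiagram n) → NonCrossing z → ∀ {a b c d} →
  a < c → c < b → b < d → 0 < arcs z a b → 0 < arcs z c d → ⊥
¬crossing z nc {a} {b} {c} {d} a<c c<b b<d ab>0 cd>0 with nc a b c d a<c c<b b<d
... | inj₁ ab≡0 = <-irrefl (sym ab≡0) ab>0
... | inj₂ cd≡0 = <-irrefl (sym cd≡0) cd>0

Between : ℕ → ℕ → ℕ → Set
Between a b c = (a < c × c < b) ⊎ (b < c × c < a)

Beyond : ℕ → ℕ → ℕ → Set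
Beyond a b d = (d < a × d < b) ⊎ (a < d × b < d)

Interleaved : ℕ → ℕ → ℕ → ℕ → Set
Interleaved a b c d = (Between a b c × Beyond a b d) ⊎ (Between a b d × Beyond a b c)

Between⇒¬Beyond : ∀ {a b c} → Between a b c → ¬ Beyond a b c
Between⇒¬Beyond (inj₁ (a<c , _)) (inj₁ (c<a , _)) = <-asym a<c c<a
Between⇒¬Beyond (inj₁ (_ , c<b)) (inj₂ (_ , b<c)) = <-asym c<b b<c
Between⇒¬Beyond (inj₂ (_ , c<a)) (inj₂ (a<c , _)) = <-asym c<a a<c
Between⇒¬Beyond (inj₂ (b<c , _)) (inj₁ (_ , c<b)) = <-asym b<c c<b

¬interleaved : ∀ {n} (z : RawDiagram n) → NonCrossing z → ∀ {a b c d} →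
  0 < mult z a b → 0 < mult z c d → Interleaved a b c d → ⊥
¬interleaved z nc ab>0 cd>0 (inj₁ (c-in , d-out)) = ¬separated ab>0 cd>0 c-in d-out
  where
  ¬separated : ∀ {a b c d} → 0 < mult z a b → 0 < mult z c d → Between a b c → Beyond a b d → ⊥
  ¬separated ab>0 cd>0 (inj₁ (a<c , c<b)) (inj₁ (d<a , _)) =
    ¬crossing z nc d<a a<c c<b (subst (0 <_) (mult-> z (<-trans d<a a<c)) cd>0) (subst (0 <_) (mult-< z (<-trans a<c c<b)) ab>0)
  ¬separated ab>0 cd>0 (inj₁ (a<c , c<b)) (inj₂ (_ , b<d)) =
    ¬crossing z nc a<c c<b b<d (subst (0 <_) (mult-< z (<-trans a<c c<b)) ab>0) (subst (0 <_) (mult-< z (<-trans c<b b<d)) cd>0)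
  ¬separated ab>0 cd>0 (inj₂ (b<c , c<a)) (inj₁ (_ , d<b)) =
    ¬crossing z nc d<b b<c c<a (subst (0 <_) (mult-> z (<-trans d<b b<c)) cd>0) (subst (0 <_) (mult-> z (<-trans b<c c<a)) ab>0)
  ¬separated ab>0 cd>0 (inj₂ (b<c , c<a)) (inj₂ (a<d , _)) =
    ¬crossing z nc b<c c<a a<d (subst (0 <_) (mult-> z (<-trans b<c c<a)) ab>0) (subst (0 <_) (mult-< z (<-trans c<a a<d)) cd>0)
¬interleaved z nc ab>0 cd>0 (inj₂ (d-in , c-out)) =
  ¬interleaved z nc ab>0 (mult-pos-comm z cd>0) (inj₁ (d-in , c-out))

module _ (c : ℕ → Bool) (m : ℕ → ℕ → ℕ) (k : ℕ) where

  crossDegree : ℕ → ℕ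
  crossDegree v = ∑[ u < k ] (if c u xor c v then m u v else 0)

  handshake : (∀ u v → m u v ≡ m v u) →
    ∑[ v < k ] (if c v then 0 else crossDegree v) ≡ ∑[ v < k ] (if c v then crossDegree v else 0)
  handshake m-comm = begin
    ∑[ v < k ] (if c v then 0 else crossDegree v) ≡⟨ sumBelow-cong k (λ _ → if-then-0 (c _) _) ⟩
    ∑[ v < k ] ∑[ u < k ] F u v                    ≡⟨ sumBelow-comm k k F ⟩
    ∑[ u < k ] ∑[ v < k ] F u v                    ≡⟨ sumBelow-cong k (λ _ → sumBelow-cong k (λ _ → F≡G _ _)) ⟩
    ∑[ u < k ] ∑[ v < k ] G u v                    ≡⟨ sumBelow-cong k (λ _ → if-else-0 (c _) _) ⟨
    ∑[ u < k ] (if c u then crossDegree u else 0) ∎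
    where
    open ≡-Reasoning
    F G : ℕ → ℕ → ℕ
    F u v = if c v then 0 else (if c u xor c v then m u v else 0)
    G u v = if c u then (if c v xor c u then m v u else 0) else 0
    F≡G : ∀ u v → F u v ≡ G u v
    F≡G u v with c u | c v
    ... | true  | true  = refl
    ... | true  | false = m-comm u v
    ... | false | true  = refl
    ... | false | false = refl
    if-then-0 : ∀ b (h : ℕ → ℕ) → (if b then 0 else ∑[ u < k ] h u) ≡ ∑[ u < k ] (if b then 0 else h u)
    if-then-0 true  h = sym (sumBelow-zero k (λ _ → refl))
    if-then-0 false h = refl
    if-else-0 : ∀ b (h : ℕ → ℕ) → (if b then ∑[ u < k ] h u else 0) ≡ ∑[ u < k ] (if b then h u else 0)
    if-else-0 true  h = refl
    if-else-0 false h = sym (sumBelow-zero k (λ _ → refl))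

-- Border thickness

border : ∀ {n} → RawDiagram n → ℕ → ℕ
border {n} z v = if v <ᵇ n then mult z v (suc v) else mult z n 0

module _ {n} (z : RawDiagram n) where

  border-< : ∀ {v} → v < n → border z v ≡ mult z v (suc v)
  border-< {v} v<n rewrite dec-true (v <? n) v<n = refl

  border-n : border z n ≡ mult z n 0
  border-n rewrite dec-false (n <? n) (<-irrefl refl) = refl

  borderThickness≤border : ∀ {v} → v ≤ n → borderThickness z ≤ border z v
  borderThickness≤border {v} v≤n with m≤n⇒m<n∨m≡n v≤n
  ... | inj₁ v<n  = subst (borderThickness z ≤_) (sym (border-< v<n)) (foldr-⊓≤ (upTo n) (∈-upTo⁺ v<n))
    where
    foldr-⊓≤ : ∀ vs {v} → v ∈ vs → foldr _⊓_ (mult z n 0) (map (λ v → mult z v (suc v)) vs) ≤ mult z v (suc v)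
    foldr-⊓≤ (v ∷ vs) (here refl) = m⊓n≤m (mult z v (suc v)) _
    foldr-⊓≤ (w ∷ vs) (there v∈)  = ≤-trans (m⊓n≤n (mult z w (suc w)) _) (foldr-⊓≤ vs v∈)
  ... | inj₂ refl = subst (borderThickness z ≤_) (sym border-n) (foldr-⊓≤base (upTo n))
    where
    foldr-⊓≤base : ∀ vs → foldr _⊓_ (mult z n 0) (map (λ v → mult z v (suc v)) vs) ≤ mult z n 0
    foldr-⊓≤base []       = ≤-refl
    foldr-⊓≤base (v ∷ vs) = ≤-trans (m⊓n≤n (mult z v (suc v)) _) (foldr-⊓≤base vs)

  ≤borderThickness : ∀ {t} → (∀ {v} → v ≤ n → t ≤ border z v) → t ≤ borderThickness z
  ≤borderThickness {t} t≤border = ≤-foldr-⊓ (upTo n) (λ v∈ → t≤pair (∈-upTo⁻ v∈))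
    where
    t≤pair : ∀ {v} → v < n → t ≤ mult z v (suc v)
    t≤pair v<n = subst (t ≤_) (border-< v<n) (t≤border (<⇒≤ v<n))
    ≤-foldr-⊓ : ∀ vs → (∀ {v} → v ∈ vs → t ≤ mult z v (suc v)) →
                t ≤ foldr _⊓_ (mult z n 0) (map (λ v → mult z v (suc v)) vs)
    ≤-foldr-⊓ []       _        = subst (t ≤_) border-n (t≤border ≤-refl)
    ≤-foldr-⊓ (v ∷ vs) t≤border = ⊓-glb (t≤border (here refl)) (≤-foldr-⊓ vs (t≤border ∘ there))

borderThickness-≤ : ∀ {n} (z w : RawDiagram n) {e₁ e₂} → e₁ ≤ n → e₂ ≤ n →
  border z e₁ ⊓ border z e₂ ≤ border w e₁ ⊓ border w e₂ →
  (∀ {v} → v ≤ n → v ≢ e₁ → v ≢ e₂ → ∃ λ u → u ≤ n × border w v ≡ border z u) →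
  borderThickness z ≤ borderThickness w
borderThickness-≤ {n} z w {e₁} {e₂} e₁≤n e₂≤n ends≤ elsewhere = ≤borderThickness w bt≤
  where
  bt≤ends : borderThickness z ≤ border w e₁ ⊓ border w e₂
  bt≤ends = ≤-trans (⊓-glb (borderThickness≤border z e₁≤n) (borderThickness≤border z e₂≤n)) ends≤
  bt≤ : ∀ {v} → v ≤ n → borderThickness z ≤ border w v
  bt≤ {v} v≤n with v ≟ e₁ | v ≟ e₂
  ... | yes refl | _        = ≤-trans bt≤ends (m⊓n≤m _ _)
  ... | no  _    | yes refl = ≤-trans bt≤ends (m⊓n≤n _ _)
  ... | no  v≢e₁ | no  v≢e₂ = let u , u≤n , eq = elsewhere v≤n v≢e₁ v≢e₂ in
    subst (borderThickness z ≤_) (sym eq) (borderThickness≤border z u≤n)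

-- The interval P..Q and its reflection

module Interval (P Q : ℕ) (P≤Q : P ≤ Q) where

  Inside Outside : ℕ → Set
  Inside v = P ≤ v × v ≤ Q
  Outside v = v < P ⊎ Q < v

  inside? : ∀ v → Inside v ⊎ Outside v
  inside? v with P ≤? v | v ≤? Q
  ... | yes P≤v | yes v≤Q = inj₁ (P≤v , v≤Q)
  ... | no  P≰v | _       = inj₂ (inj₁ (≰⇒> P≰v))
  ... | yes _   | no  v≰Q = inj₂ (inj₂ (≰⇒> v≰Q))

  Inside-P : Inside P
  Inside-P = ≤-refl , P≤Q

  Inside-Q : Inside Q
  Inside-Q = P≤Q , ≤-refl

  inside-Inside : ∀ {v} → Inside v → inside P Q v ≡ true
  inside-Inside {v} (P≤v , v≤Q) = cong₂ _∧_ (dec-true (P ≤? v) P≤v) (dec-true (v ≤? Q) v≤Q)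

  inside-Outside : ∀ {v} → Outside v → inside P Q v ≡ false
  inside-Outside {v} (inj₁ v<P) = cong (_∧ (v ≤ᵇ Q)) (dec-false (P ≤? v) (<⇒≱ v<P))
  inside-Outside {v} (inj₂ Q<v) = trans (cong ((P ≤ᵇ v) ∧_) (dec-false (v ≤? Q) (<⇒≱ Q<v))) (∧-zeroʳ (P ≤ᵇ v))

  Outside-¬Between : ∀ {a b o} → Inside a → Inside b → Outside o → ¬ Between a b o
  Outside-¬Between (P≤a , _) _ (inj₁ o<P) (inj₁ (a<o , _)) = <-asym a<o (<-≤-trans o<P P≤a)
  Outside-¬Between _ (_ , b≤Q) (inj₂ Q<o) (inj₁ (_ , o<b)) = <-asym o<b (≤-<-trans b≤Q Q<o)
  Outside-¬Between _ (P≤b , _) (inj₁ o<P) (inj₂ (b<o , _)) = <-asym b<o (<-≤-trans o<P P≤b)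
  Outside-¬Between (_ , a≤Q) _ (inj₂ Q<o) (inj₂ (_ , o<a)) = <-asym o<a (≤-<-trans a≤Q Q<o)

  Outside-Beyond : ∀ {a b o} → Inside a → Inside b → Outside o → Beyond a b o
  Outside-Beyond (P≤a , _) (P≤b , _) (inj₁ o<P) = inj₁ (<-≤-trans o<P P≤a , <-≤-trans o<P P≤b)
  Outside-Beyond (_ , a≤Q) (_ , b≤Q) (inj₂ Q<o) = inj₂ (≤-<-trans a≤Q Q<o , ≤-<-trans b≤Q Q<o)

  Outside-below : ∀ {o i} → Outside o → Inside i → o < i → o < P
  Outside-below (inj₁ o<P) _         _   = o<P
  Outside-below (inj₂ Q<o) (_ , i≤Q) o<i = ⊥-elim (<-asym o<i (≤-<-trans i≤Q Q<o))

  Outside-above : ∀ {o i} → Outside o → Inside i → i < o → Q < o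
  Outside-above (inj₂ Q<o) _         _   = Q<o
  Outside-above (inj₁ o<P) (P≤i , _) i<o = ⊥-elim (<-asym i<o (<-≤-trans o<P P≤i))

  Between-Inside : ∀ {a b i u} → Outside a → Outside b → Inside i → Inside u → Between a b i → Between a b u
  Between-Inside oa ob ii (P≤u , u≤Q) (inj₁ (a<i , i<b)) =
    inj₁ (<-≤-trans (Outside-below oa ii a<i) P≤u , ≤-<-trans u≤Q (Outside-above ob ii i<b))
  Between-Inside oa ob ii (P≤u , u≤Q) (inj₂ (b<i , i<a)) =
    inj₂ (<-≤-trans (Outside-below ob ii b<i) P≤u , ≤-<-trans u≤Q (Outside-above oa ii i<a))

  Beyond-Inside : ∀ {a b i u} → Outside a → Outside b → Inside i → Inside u → Beyond a b i → Beyond a b u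
  Beyond-Inside oa ob ii (_ , u≤Q) (inj₁ (i<a , i<b)) =
    inj₁ (≤-<-trans u≤Q (Outside-above oa ii i<a) , ≤-<-trans u≤Q (Outside-above ob ii i<b))
  Beyond-Inside oa ob ii (P≤u , _) (inj₂ (a<i , b<i)) =
    inj₂ (<-≤-trans (Outside-below oa ii a<i) P≤u , <-≤-trans (Outside-below ob ii b<i) P≤u)

  ρ-Inside : ∀ {v} → Inside v → ρ P Q v ≡ P + Q ∸ v
  ρ-Inside {v} iv rewrite inside-Inside iv = refl

  ≤P+Q : ∀ {v} → Inside v → v ≤ P + Q
  ≤P+Q (_ , v≤Q) = ≤-trans v≤Q (m≤n+m Q P)

  ρ-preserves-Inside : ∀ {v} → Inside v → Inside (ρ P Q v)
  ρ-preserves-Inside {v} iv@(P≤v , v≤Q) rewrite ρ-Inside iv =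
    subst (_≤ P + Q ∸ v) (m+n∸n≡m P Q) (∸-monoʳ-≤ (P + Q) v≤Q) ,
    subst (P + Q ∸ v ≤_) (m+n∸m≡n P Q) (∸-monoʳ-≤ (P + Q) P≤v)

  ρ-involutive : ∀ {v} → Inside v → ρ P Q (ρ P Q v) ≡ v
  ρ-involutive {v} iv rewrite ρ-Inside (ρ-preserves-Inside iv) | ρ-Inside iv = m∸[m∸n]≡n (≤P+Q iv)

  ρ-reverses-< : ∀ {a b} → Inside a → Inside b → a < b → ρ P Q b < ρ P Q a
  ρ-reverses-< ia ib a<b rewrite ρ-Inside ia | ρ-Inside ib = ∸-monoʳ-< a<b (≤P+Q ib)

  ρ-antitone : ∀ {a b} → Inside a → Inside b → a ≤ b → ρ P Q b ≤ ρ P Q a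
  ρ-antitone ia ib a≤b rewrite ρ-Inside ia | ρ-Inside ib = ∸-monoʳ-≤ (P + Q) a≤b

  ρ-P : ρ P Q P ≡ Q
  ρ-P = trans (ρ-Inside Inside-P) (m+n∸m≡n P Q)

  ρ-Q : ρ P Q Q ≡ P
  ρ-Q = trans (ρ-Inside Inside-Q) (m+n∸n≡m P Q)

  ρ-suc : ∀ {v} → Inside v → Inside (suc v) → ρ P Q v ≡ suc (ρ P Q (suc v))
  ρ-suc {v} iv isv rewrite ρ-Inside iv | ρ-Inside isv = +-∸-assoc 1 (≤P+Q isv)

  ρ-Between : ∀ {a b c} → Inside a → Inside b → Inside c → Between a b c → Between (ρ P Q a) (ρ P Q b) (ρ P Q c)
  ρ-Between ia ib ic (inj₁ (a<c , c<b)) = inj₂ (ρ-reverses-< ic ib c<b , ρ-reverses-< ia ic a<c)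
  ρ-Between ia ib ic (inj₂ (b<c , c<a)) = inj₁ (ρ-reverses-< ic ia c<a , ρ-reverses-< ib ic b<c)

  ρ-Beyond : ∀ {a b d} → Inside a → Inside b → Inside d → Beyond a b d → Beyond (ρ P Q a) (ρ P Q b) (ρ P Q d)
  ρ-Beyond ia ib id (inj₁ (d<a , d<b)) = inj₂ (ρ-reverses-< id ia d<a , ρ-reverses-< id ib d<b)
  ρ-Beyond ia ib id (inj₂ (a<d , b<d)) = inj₁ (ρ-reverses-< ia id a<d , ρ-reverses-< ib id b<d)

  ρ-Interleaved : ∀ {a b c d} → Inside a → Inside b → Inside c → Inside d →
    Interleaved a b c d → Interleaved (ρ P Q a) (ρ P Q b) (ρ P Q c) (ρ P Q d)
  ρ-Interleaved ia ib ic id (inj₁ (c-in , d-out)) = inj₁ (ρ-Between ia ib ic c-in , ρ-Beyond ia ib id d-out)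
  ρ-Interleaved ia ib ic id (inj₂ (d-in , c-out)) = inj₂ (ρ-Between ia ib id d-in , ρ-Beyond ia ib ic c-out)

-- One generator

module Generator {n : ℕ} (p q : Fin n) (p<q : p Fin.< q) (x : RawDiagram n) where

  P Q : ℕ
  P = suc (toℕ p)
  Q = suc (toℕ q)

  P≤Q : P ≤ Q
  P≤Q = <⇒≤ (s≤s p<q)

  Q≤n : Q ≤ n
  Q≤n = toℕ<n q

  open Interval P Q P≤Q

  y : RawDiagram n
  y = actGen (p , q , p<q) x

  ρ′ : ℕ → ℕ
  ρ′ = ρ P Q

  crossingTerm : ℕ → ℕ → ℕ
  crossingTerm v u = if inside P Q u xor inside P Q v then mult x u v else 0

  crossings : ℕ → ℕ
  crossings v = sum (map (crossingTerm v) (upTo (suc n)))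

  crossings-∑ : ∀ v → crossings v ≡ ∑[ u < suc n ] crossingTerm v u
  crossings-∑ v = sum-map-upTo (suc n) (crossingTerm v)

  crossingTerm-in-out : ∀ {u v} → Inside u → Outside v → crossingTerm v u ≡ mult x u v
  crossingTerm-in-out iu ov rewrite inside-Inside iu | inside-Outside ov = refl

  crossingTerm-out-in : ∀ {u v} → Outside u → Inside v → crossingTerm v u ≡ mult x u v
  crossingTerm-out-in ou iv rewrite inside-Outside ou | inside-Inside iv = refl

  crossingTerm-Inside : ∀ {u v} → Inside v → crossingTerm v u ≢ 0 → Outside u × 0 < mult x u v
  crossingTerm-Inside {u} {v} iv t≢0 with inside? u
  ... | inj₁ iu rewrite inside-Inside iu | inside-Inside iv = ⊥-elim (t≢0 refl)
  ... | inj₂ ou = ou , n≢0⇒n>0 (t≢0 ∘ trans (crossingTerm-out-in ou iv))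

  crossingTerm-Outside : ∀ {u v} → Outside v → crossingTerm v u ≢ 0 → Inside u × 0 < mult x u v
  crossingTerm-Outside {u} {v} ov t≢0 with inside? u
  ... | inj₂ ou rewrite inside-Outside ou | inside-Outside ov = ⊥-elim (t≢0 refl)
  ... | inj₁ iu = iu , n≢0⇒n>0 (t≢0 ∘ trans (crossingTerm-in-out iu ov))

  mult≤crossings : ∀ {u v} → u ≤ n → crossingTerm v u ≡ mult x u v → mult x u v ≤ crossings v
  mult≤crossings {u} {v} u≤n t≡mult =
    subst₂ _≤_ t≡mult (sym (crossings-∑ v)) (term≤sumBelow (crossingTerm v) (s≤s u≤n))

  crossings-pos : ∀ v → 0 < crossings v → ∃ λ u → 0 < crossingTerm v u
  crossings-pos v pos = let u , _ , t>0 = sumBelow-pos (suc n) (crossingTerm v) (subst (0 <_) (crossings-∑ v) pos) in u , t>0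

  outerList : List ℕ
  outerList = downFrom P ++ applyDownFrom (suc Q +_) (n ∸ Q)

  innerList : List ℕ
  innerList = applyDownFrom (P +_) (suc (Q ∸ P))

  outerEnds : List ℕ
  outerEnds = replicateEach crossings outerList

  innerEnds : List ℕ
  innerEnds = map ρ′ (replicateEach crossings innerList)

  rejoined : List (ℕ × ℕ)
  rejoined = zip outerEnds innerEnds

  reverse-range : ∀ a k → reverse (range a k) ≡ applyDownFrom (a +_) k
  reverse-range a k = begin
    reverse (map (a +_) (upTo k)) ≡⟨ List.reverse-map (a +_) (upTo k) ⟨
    map (a +_) (reverse (upTo k)) ≡⟨ cong (map (a +_)) (List.reverse-upTo k) ⟩
    map (a +_) (downFrom k)       ≡⟨ List.map-applyDownFrom id (a +_) k ⟩
    applyDownFrom (a +_) k        ∎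
    where open ≡-Reasoning

  -- The left-hand side is the list newCross in the definition of actGen.
  rejoined-defn : zip (replicateEach crossings (reverse (upTo P) ++ reverse (range (suc Q) (n ∸ Q))))
                      (reverse (map ρ′ (replicateEach crossings (range P (suc (Q ∸ P))))))
                  ≡ rejoined
  rejoined-defn = cong₂ zip
    (cong (replicateEach crossings) (cong₂ _++_ (List.reverse-upTo P) (reverse-range (suc Q) (n ∸ Q))))
    (begin
      reverse (map ρ′ (replicateEach crossings inner)) ≡⟨ List.reverse-map ρ′ (replicateEach crossings inner) ⟨
      map ρ′ (reverse (replicateEach crossings inner)) ≡⟨ cong (map ρ′) (reverse-replicateEach crossings inner) ⟩
      map ρ′ (replicateEach crossings (reverse inner)) ≡⟨ cong (map ρ′ ∘ replicateEach crossings) (reverse-range P (suc (Q ∸ P))) ⟩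
      innerEnds                                          ∎)
    where
    open ≡-Reasoning
    inner = range P (suc (Q ∸ P))

  arcs-y-outer : ∀ {i j} → Outside i → Outside j → i < j → arcs y i j ≡ mult x i j
  arcs-y-outer oi oj i<j rewrite <ᵇ-true i<j | inside-Outside oi | inside-Outside oj = refl

  arcs-y-inner : ∀ {i j} → Inside i → Inside j → i < j → arcs y i j ≡ mult x (ρ′ i) (ρ′ j)
  -- The second pass rewrites the tests inside the reflections exposed by the first.
  arcs-y-inner ii ij i<j rewrite <ᵇ-true i<j | inside-Inside ii | inside-Inside ij | inside-Inside ii | inside-Inside ij = refl

  arcs-y-in-out : ∀ {i j} → Inside i → Outside j → i < j → arcs y i j ≡ countPair j i rejoined
  arcs-y-in-out {i} {j} ii oj i<j rewrite <ᵇ-true i<j | inside-Inside ii | inside-Outside oj = cong (countPair j i) rejoined-defn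

  arcs-y-out-in : ∀ {i j} → Outside i → Inside j → i < j → arcs y i j ≡ countPair i j rejoined
  arcs-y-out-in {i} {j} oi ij i<j rewrite <ᵇ-true i<j | inside-Outside oi | inside-Inside ij = cong (countPair i j) rejoined-defn

  -- o₁ is reached no later than o₂ walking from P - 1 down to 0 and then from n down to Q + 1.
  OuterBefore : ℕ → ℕ → Set
  OuterBefore o₁ o₂ = (o₂ ≤ o₁ × o₁ < P) ⊎ (o₁ < P × Q < o₂) ⊎ (Q < o₂ × o₂ ≤ o₁)

  outerList-Outside : All Outside outerList
  outerList-Outside = All.++⁺ (All.applyDownFrom⁺₁ id P inj₁)
    (All.applyDownFrom⁺₁ (suc Q +_) (n ∸ Q) (λ {j} _ → inj₂ (s≤s (m≤m+n Q j))))

  outerEnds-sorted : AllPairs OuterBefore outerEnds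
  outerEnds-sorted = AllPairs-replicateEach crossings (All.map OuterBefore-refl outerList-Outside)
    (AllPairs.++⁺
      (AllPairs.applyDownFrom⁺₁ id P (λ j<i i<P → inj₁ (<⇒≤ j<i , i<P)))
      (AllPairs.applyDownFrom⁺₁ (suc Q +_) (n ∸ Q)
        (λ {_} {j} j<i _ → inj₂ (inj₂ (s≤s (m≤m+n Q j) , +-monoʳ-≤ (suc Q) (<⇒≤ j<i)))))
      (All.applyDownFrom⁺₁ id P (λ i<P →
        All.applyDownFrom⁺₁ (suc Q +_) (n ∸ Q) (λ {j} _ → inj₂ (inj₁ (i<P , s≤s (m≤m+n Q j)))))))
    where
    OuterBefore-refl : ∀ {o} → Outside o → OuterBefore o o
    OuterBefore-refl (inj₁ o<P) = inj₁ (≤-refl , o<P)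
    OuterBefore-refl (inj₂ Q<o) = inj₂ (inj₂ (Q<o , ≤-refl))

  Inside-P+ : ∀ {i} → i < suc (Q ∸ P) → Inside (P + i)
  Inside-P+ {i} i≤Q∸P = m≤m+n P i , subst (P + i ≤_) (m+[n∸m]≡n P≤Q) (+-monoʳ-≤ P (s≤s⁻¹ i≤Q∸P))

  innerList-Inside : All Inside innerList
  innerList-Inside = All.applyDownFrom⁺₁ (P +_) (suc (Q ∸ P)) Inside-P+

  innerEnds-sorted : AllPairs _≤_ innerEnds
  innerEnds-sorted = AllPairs.map⁺ (AllPairs-replicateEach crossings (All.map (λ _ → ≤-refl) innerList-Inside)
    (AllPairs.applyDownFrom⁺₁ (P +_) (suc (Q ∸ P))
      (λ j<i i<k → ρ-antitone (Inside-P+ (<-trans j<i i<k)) (Inside-P+ i<k) (+-monoʳ-≤ P (<⇒≤ j<i)))))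

  rejoined-sorted : AllPairs (OuterBefore ⟨×⟩ _≤_) rejoined
  rejoined-sorted = AllPairs-zip outerEnds-sorted innerEnds-sorted

  ∈-outerEnds : ∀ {o} → o ∈ outerEnds → Outside o × ∃ λ u → Inside u × 0 < mult x o u
  ∈-outerEnds o∈ =
    let o∈list , c>0 = ∈-replicateEach⁻ crossings outerList o∈
        oo = All.lookup outerList-Outside o∈list
        u , t>0 = crossings-pos _ c>0
        iu , pos = crossingTerm-Outside oo (m<n⇒n≢0 t>0)
    in oo , u , iu , mult-pos-comm x pos

  ∈-innerEnds : ∀ {i} → i ∈ innerEnds → Inside i × ∃ λ o → Outside o × 0 < mult x o (ρ′ i)
  ∈-innerEnds i∈ with ∈-map⁻ ρ′ i∈
  ... | w , w∈ , refl =
    let w∈list , c>0 = ∈-replicateEach⁻ crossings innerList w∈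
        iw = All.lookup innerList-Inside w∈list
        o , t>0 = crossings-pos _ c>0
        oo , pos = crossingTerm-Inside iw (m<n⇒n≢0 t>0)
    in ρ-preserves-Inside iw , o , oo , subst (λ v → 0 < mult x o v) (sym (ρ-involutive iw)) pos

  ∈-rejoined : ∀ {o i} → (o , i) ∈ rejoined → o ∈ outerEnds × i ∈ innerEnds
  ∈-rejoined = ∈-zip⁻ outerEnds innerEnds

  -- Non-crossing is preserved

  data RejoinedArc : ℕ → ℕ → Set where
    out-in : ∀ {a b} → (a , b) ∈ rejoined → RejoinedArc a b
    in-out : ∀ {a b} → (b , a) ∈ rejoined → RejoinedArc a b

  data Arc : ℕ → ℕ → Set where
    outer    : ∀ {a b} → Outside a → Outside b → 0 < mult x a b → Arc a b
    inner    : ∀ {a b} → Inside a → Inside b → 0 < mult x (ρ′ a) (ρ′ b) → Arc a b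
    crossing : ∀ {a b} → RejoinedArc a b → Arc a b

  arc : ∀ {a b} → a < b → 0 < arcs y a b → Arc a b
  arc {a} {b} a<b pos with inside? a | inside? b
  ... | inj₂ oa | inj₂ ob = outer oa ob (subst (0 <_) (arcs-y-outer oa ob a<b) pos)
  ... | inj₁ ia | inj₁ ib = inner ia ib (subst (0 <_) (arcs-y-inner ia ib a<b) pos)
  ... | inj₂ oa | inj₁ ib = crossing (out-in (countPair-pos a b rejoined (subst (0 <_) (arcs-y-out-in oa ib a<b) pos)))
  ... | inj₁ ia | inj₂ ob = crossing (in-out (countPair-pos b a rejoined (subst (0 <_) (arcs-y-in-out ia ob a<b) pos)))

  ¬interleaved-outer-inner : ∀ {a b c d} → Outside a → Outside b → Inside c → Inside d → ¬ Interleaved a b c d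
  ¬interleaved-outer-inner oa ob ic id (inj₁ (c-btw , d-bey)) = Between⇒¬Beyond (Between-Inside oa ob ic id c-btw) d-bey
  ¬interleaved-outer-inner oa ob ic id (inj₂ (d-btw , c-bey)) = Between⇒¬Beyond (Between-Inside oa ob id ic d-btw) c-bey

  -- Both coordinates of rejoined are sorted, so two rejoined arcs are nested.
  ¬crossing-rejoined : ∀ {a b c d} → a < c → c < b → b < d → RejoinedArc a b → RejoinedArc c d → ⊥
  ¬crossing-rejoined a<c c<b b<d (out-in ab∈) (out-in cd∈)
    with AllPairs-∈ rejoined-sorted ab∈ cd∈ | proj₁ (∈-innerEnds (proj₂ (∈-rejoined ab∈)))
  ... | inj₁ (inj₁ (c≤a , _) , _)        | _         = <⇒≱ a<c c≤a
  ... | inj₁ (inj₂ (inj₁ (_ , Q<c)) , _) | (_ , b≤Q) = <-asym c<b (≤-<-trans b≤Q Q<c)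
  ... | inj₁ (inj₂ (inj₂ (_ , c≤a)) , _) | _         = <⇒≱ a<c c≤a
  ... | inj₂ (inj₁ (_ , d≤b))            | _         = <⇒≱ b<d d≤b
  ... | inj₂ (inj₂ refl)                 | _         = <-irrefl refl a<c
  ¬crossing-rejoined a<c c<b b<d (out-in ab∈) (in-out dc∈)
    with AllPairs-∈ rejoined-sorted ab∈ dc∈
       | proj₁ (∈-innerEnds (proj₂ (∈-rejoined ab∈))) | proj₁ (∈-innerEnds (proj₂ (∈-rejoined dc∈)))
  ... | inj₁ (_ , b≤c)                          | _         | _         = <⇒≱ c<b b≤c
  ... | inj₂ (inj₁ (inj₁ (_ , d<P) , _))        | (P≤b , _) | _         = <-asym b<d (<-≤-trans d<P P≤b)
  ... | inj₂ (inj₁ (inj₂ (inj₁ (d<P , _)) , _)) | (P≤b , _) | _         = <-asym b<d (<-≤-trans d<P P≤b)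
  ... | inj₂ (inj₁ (inj₂ (inj₂ (Q<a , _)) , _)) | _         | (_ , c≤Q) = <-asym a<c (≤-<-trans c≤Q Q<a)
  ... | inj₂ (inj₂ refl)                        | _         | _         = <-irrefl refl (<-trans (<-trans a<c c<b) b<d)
  ¬crossing-rejoined a<c c<b b<d (in-out ba∈) (in-out dc∈)
    with AllPairs-∈ rejoined-sorted ba∈ dc∈ | proj₁ (∈-innerEnds (proj₂ (∈-rejoined dc∈)))
  ... | inj₁ (inj₁ (d≤b , _) , _)        | _         = <⇒≱ b<d d≤b
  ... | inj₁ (inj₂ (inj₁ (b<P , _)) , _) | (P≤c , _) = <-asym c<b (<-≤-trans b<P P≤c)
  ... | inj₁ (inj₂ (inj₂ (_ , d≤b)) , _) | _         = <⇒≱ b<d d≤b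
  ... | inj₂ (inj₁ (_ , c≤a))            | _         = <⇒≱ a<c c≤a
  ... | inj₂ (inj₂ refl)                 | _         = <-irrefl refl b<d
  ¬crossing-rejoined a<c c<b b<d (in-out ba∈) (out-in cd∈) =
    Outside-¬Between (proj₁ (∈-innerEnds (proj₂ (∈-rejoined ba∈)))) (proj₁ (∈-innerEnds (proj₂ (∈-rejoined cd∈))))
      (proj₁ (∈-outerEnds (proj₁ (∈-rejoined cd∈)))) (inj₁ (a<c , <-trans c<b b<d))

  module _ (nc : NonCrossing x) where

    ¬interleaved-inner-rejoined : ∀ {a b o i} → Inside a → Inside b → 0 < mult x (ρ′ a) (ρ′ b) →
      (o , i) ∈ rejoined → ¬ Interleaved a b o i
    ¬interleaved-inner-rejoined ia ib ab>0 oi∈ (inj₁ (o-btw , _)) =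
      Outside-¬Between ia ib (proj₁ (∈-outerEnds (proj₁ (∈-rejoined oi∈)))) o-btw
    ¬interleaved-inner-rejoined ia ib ab>0 oi∈ (inj₂ (i-btw , _)) =
      let ii , o′ , oo′ , pos = ∈-innerEnds (proj₂ (∈-rejoined oi∈))
      in ¬interleaved x nc ab>0 (mult-pos-comm x pos)
           (inj₁ (ρ-Between ia ib ii i-btw , Outside-Beyond (ρ-preserves-Inside ia) (ρ-preserves-Inside ib) oo′))

    ¬interleaved-outer-rejoined : ∀ {a b o i} → Outside a → Outside b → 0 < mult x a b →
      (o , i) ∈ rejoined → ¬ Interleaved a b o i
    ¬interleaved-outer-rejoined {a} {b} oa ob ab>0 oi∈ intl =
      let o∈ , i∈ = ∈-rejoined oi∈
          _ , u , iu , pos = ∈-outerEnds o∈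
          ii = proj₁ (∈-innerEnds i∈)
      in ¬interleaved x nc ab>0 pos (moveInner ii iu intl)
      where
      moveInner : ∀ {o i u} → Inside i → Inside u → Interleaved a b o i → Interleaved a b o u
      moveInner ii iu (inj₁ (o-btw , i-bey)) = inj₁ (o-btw , Beyond-Inside oa ob ii iu i-bey)
      moveInner ii iu (inj₂ (i-btw , o-bey)) = inj₂ (Between-Inside oa ob ii iu i-btw , o-bey)

    ¬crossing-arcs : ∀ {a b c d} → a < c → c < b → b < d → Arc a b → Arc c d → ⊥
    ¬crossing-arcs {a} {b} {c} {d} a<c c<b b<d =
      let I₁ : Interleaved a b c d
          I₁ = inj₁ (inj₁ (a<c , c<b) , inj₂ (<-trans a<c (<-trans c<b b<d) , b<d))
          I₂ : Interleaved c d a b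
          I₂ = inj₂ (inj₁ (c<b , b<d) , inj₁ (a<c , <-trans a<c (<-trans c<b b<d)))
      in λ where
        (outer oa ob ab>0) (outer _ _ cd>0)  → ¬interleaved x nc ab>0 cd>0 I₁
        (outer oa ob _)    (inner ic id _)   → ¬interleaved-outer-inner oa ob ic id I₁
        (inner ia ib _)    (outer oc od _)   → ¬interleaved-outer-inner oc od ia ib I₂
        (inner ia ib ab>0) (inner ic id cd>0) → ¬interleaved x nc ab>0 cd>0 (ρ-Interleaved ia ib ic id I₁)
        (outer oa ob ab>0) (crossing (out-in cd∈)) → ¬interleaved-outer-rejoined oa ob ab>0 cd∈ I₁
        (outer oa ob ab>0) (crossing (in-out dc∈)) → ¬interleaved-outer-rejoined oa ob ab>0 dc∈ (swap I₁)
        (inner ia ib ab>0) (crossing (out-in cd∈)) → ¬interleaved-inner-rejoined ia ib ab>0 cd∈ I₁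
        (inner ia ib ab>0) (crossing (in-out dc∈)) → ¬interleaved-inner-rejoined ia ib ab>0 dc∈ (swap I₁)
        (crossing (out-in ab∈)) (outer oc od cd>0) → ¬interleaved-outer-rejoined oc od cd>0 ab∈ I₂
        (crossing (in-out ba∈)) (outer oc od cd>0) → ¬interleaved-outer-rejoined oc od cd>0 ba∈ (swap I₂)
        (crossing (out-in ab∈)) (inner ic id cd>0) → ¬interleaved-inner-rejoined ic id cd>0 ab∈ I₂
        (crossing (in-out ba∈)) (inner ic id cd>0) → ¬interleaved-inner-rejoined ic id cd>0 ba∈ (swap I₂)
        (crossing r) (crossing s) → ¬crossing-rejoined a<c c<b b<d r s

    y-NonCrossing : NonCrossing y
    y-NonCrossing a b c d a<c c<b b<d with arcs y a b ≟ 0 | arcs y c d ≟ 0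
    ... | yes ab≡0 | _        = inj₁ ab≡0
    ... | no  _    | yes cd≡0 = inj₂ cd≡0
    ... | no  ab≢0 | no  cd≢0 = ⊥-elim (¬crossing-arcs a<c c<b b<d
      (arc (<-trans a<c c<b) (n≢0⇒n>0 ab≢0)) (arc (<-trans c<b b<d) (n≢0⇒n>0 cd≢0)))

  -- Border multiplicities

  p′ : ℕ
  p′ = toℕ p

  p′<n : p′ < n
  p′<n = <-≤-trans (<-≤-trans ≤-refl P≤Q) Q≤n

  Outside-p′ : Outside p′
  Outside-p′ = inj₁ ≤-refl

  data Next : ℕ → Set where
    next-suc  : Q < n → Next (suc Q)
    next-wrap : Q ≡ n → Next 0

  next : ∃ Next
  next with m≤n⇒m<n∨m≡n Q≤n
  ... | inj₁ Q<n  = suc Q , next-suc Q<n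
  ... | inj₂ Q≡n = 0 , next-wrap Q≡n

  Next-Outside : ∀ {r} → Next r → Outside r
  Next-Outside (next-suc _)  = inj₂ ≤-refl
  Next-Outside (next-wrap _) = inj₁ z<s

  Next-≤ : ∀ {r} → Next r → r ≤ n
  Next-≤ (next-suc Q<n) = Q<n
  Next-≤ (next-wrap _)  = z≤n

  border-Q : ∀ (z : RawDiagram n) {r} → Next r → border z Q ≡ mult z Q r
  border-Q z (next-suc Q<n)    = border-< z Q<n
  border-Q z (next-wrap Q≡n)  = trans (cong (border z) Q≡n) (trans (border-n z) (cong (λ v → mult z v 0) (sym Q≡n)))

  y-border-p′ : border y p′ ≡ countPair p′ P rejoined
  y-border-p′ = trans (border-< y p′<n) (trans (mult-< y {p′} ≤-refl) (arcs-y-out-in Outside-p′ Inside-P ≤-refl))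

  y-border-Q : ∀ {r} → Next r → border y Q ≡ countPair r Q rejoined
  y-border-Q nx@(next-suc Q<n) =
    trans (border-Q y nx) (trans (mult-< y {Q} ≤-refl) (arcs-y-in-out Inside-Q (Next-Outside nx) ≤-refl))
  y-border-Q nx@(next-wrap Q≡n) =
    trans (border-Q y nx) (trans (mult-> y 0<Q) (arcs-y-out-in (Next-Outside nx) Inside-Q 0<Q))
    where
    0<Q : 0 < Q
    0<Q = z<s

  outerEnds-prefix : ∃ λ rest → outerEnds ≡ replicate (crossings p′) p′ ++ rest × All (_≢ p′) rest
  outerEnds-prefix = _ , refl , replicateEach⁺ crossings (All.++⁺
    (All.applyDownFrom⁺₁ id p′ <⇒≢)
    (All.applyDownFrom⁺₁ (suc Q +_) (n ∸ Q) (λ {j} _ →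
      >⇒≢ (<-≤-trans ≤-refl (≤-trans P≤Q (≤-trans (n≤1+n Q) (m≤m+n (suc Q) j)))))))

  outerEnds-suffix : ∀ {r} → Next r → ∃ λ front → outerEnds ≡ front ++ replicate (crossings r) r × All (_≢ r) front
  outerEnds-suffix (next-suc Q<n) = replicateEach crossings front ,
    trans (cong (replicateEach crossings) outerList≡) (replicateEach-∷ʳ crossings front (suc Q)) ,
    replicateEach⁺ crossings (All.++⁺
      (All.applyDownFrom⁺₁ id P (λ i<P → <⇒≢ (<-≤-trans i<P (≤-trans P≤Q (n≤1+n Q)))))
      (All.applyDownFrom⁺₁ _ k (λ {j} _ → >⇒≢ (m<m+n (suc Q) z<s))))
    where
    k = n ∸ suc Q
    front = downFrom P ++ applyDownFrom (λ j → suc Q + suc j) k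
    outerList≡ : outerList ≡ front ++ suc Q ∷ []
    outerList≡ = begin
      downFrom P ++ applyDownFrom (suc Q +_) (n ∸ Q)        ≡⟨ cong (λ m → downFrom P ++ applyDownFrom (suc Q +_) m) (+-∸-assoc 1 Q<n) ⟩
      downFrom P ++ applyDownFrom (suc Q +_) (suc k)        ≡⟨ cong (downFrom P ++_) (List.applyDownFrom-∷ʳ (suc Q +_) k) ⟨
      downFrom P ++ (applyDownFrom (λ j → suc Q + suc j) k ++ (suc Q + 0) ∷ []) ≡⟨ List.++-assoc (downFrom P) _ _ ⟨
      front ++ (suc Q + 0) ∷ []                              ≡⟨ cong (λ v → front ++ v ∷ []) (+-identityʳ (suc Q)) ⟩
      front ++ suc Q ∷ []                                    ∎
      where open ≡-Reasoning
  outerEnds-suffix (next-wrap Q≡n) = replicateEach crossings front ,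
    trans (cong (replicateEach crossings) outerList≡) (replicateEach-∷ʳ crossings front 0) ,
    replicateEach⁺ crossings (All.applyDownFrom⁺₁ suc p′ (λ _ ()))
    where
    front = applyDownFrom suc p′
    outerList≡ : outerList ≡ front ++ 0 ∷ []
    outerList≡ = begin
      downFrom P ++ applyDownFrom (suc Q +_) (n ∸ Q) ≡⟨ cong (λ m → downFrom P ++ applyDownFrom (suc Q +_) (m ∸ Q)) Q≡n ⟨
      downFrom P ++ applyDownFrom (suc Q +_) (Q ∸ Q) ≡⟨ cong (λ m → downFrom P ++ applyDownFrom (suc Q +_) m) (n∸n≡0 Q) ⟩
      downFrom P ++ []                               ≡⟨ List.++-identityʳ (downFrom P) ⟩
      downFrom P                                     ≡⟨ List.downFrom-∷ʳ p′ ⟨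
      front ++ 0 ∷ []                                ∎
      where open ≡-Reasoning

  P+[Q∸P]≡Q : P + (Q ∸ P) ≡ Q
  P+[Q∸P]≡Q = m+[n∸m]≡n P≤Q

  innerEnds-prefix : ∃ λ rest → innerEnds ≡ replicate (crossings Q) P ++ rest × All (_≢ P) rest
  innerEnds-prefix = map ρ′ (replicateEach crossings rest) ,
    trans (map-replicateEach-∷ ρ′ crossings (P + (Q ∸ P)) rest)
          (cong₂ (λ v w → replicate (crossings v) w ++ map ρ′ (replicateEach crossings rest))
            P+[Q∸P]≡Q (trans (cong ρ′ P+[Q∸P]≡Q) ρ-Q)) ,
    All.map⁺ (replicateEach⁺ crossings (All.applyDownFrom⁺₁ (P +_) (Q ∸ P) ρ[P+i]≢P))
    where
    rest = applyDownFrom (P +_) (Q ∸ P)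
    ρ[P+i]≢P : ∀ {i} → i < Q ∸ P → ρ′ (P + i) ≢ P
    ρ[P+i]≢P {i} i<Q∸P = >⇒≢ (subst (_< ρ′ (P + i)) (trans (cong ρ′ P+[Q∸P]≡Q) ρ-Q)
      (ρ-reverses-< (Inside-P+ (m<n⇒m<1+n i<Q∸P)) (Inside-P+ ≤-refl) (+-monoʳ-< P i<Q∸P)))

  innerEnds-suffix : ∃ λ front → innerEnds ≡ front ++ replicate (crossings P) Q × All (_≢ Q) front
  innerEnds-suffix = map ρ′ (replicateEach crossings front) ,
    trans (cong (map ρ′ ∘ replicateEach crossings) innerList≡)
          (trans (map-replicateEach-∷ʳ ρ′ crossings front (P + 0))
                 (cong₂ (λ v w → map ρ′ (replicateEach crossings front) ++ replicate (crossings v) w)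
                   (+-identityʳ P) (trans (cong ρ′ (+-identityʳ P)) ρ-P))) ,
    All.map⁺ (replicateEach⁺ crossings (All.applyDownFrom⁺₁ _ (Q ∸ P) ρ[P+1+i]≢Q))
    where
    front = applyDownFrom (λ i → P + suc i) (Q ∸ P)
    innerList≡ : innerList ≡ front ++ (P + 0) ∷ []
    innerList≡ = sym (List.applyDownFrom-∷ʳ (P +_) (Q ∸ P))
    ρ[P+1+i]≢Q : ∀ {i} → i < Q ∸ P → ρ′ (P + suc i) ≢ Q
    ρ[P+1+i]≢Q i<Q∸P = <⇒≢ (subst (ρ′ (P + suc _) <_) ρ-P
      (ρ-reverses-< Inside-P (Inside-P+ (s≤s i<Q∸P)) (m<m+n P z<s)))

  sumBelow-split : ∀ g → ∑[ v < suc n ] g v ≡ ∑[ v < P ] g v + (∑[ i < suc (Q ∸ P) ] g (P + i) + ∑[ j < n ∸ Q ] g (suc Q + j))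
  sumBelow-split g = begin
    ∑[ v < suc n ] g v                                      ≡⟨ cong (λ k → ∑[ v < k ] g v) total ⟨
    ∑[ v < P + (suc (Q ∸ P) + (n ∸ Q)) ] g v                ≡⟨ sumBelow-+ P _ g ⟩
    ∑[ v < P ] g v + ∑[ i < suc (Q ∸ P) + (n ∸ Q) ] g (P + i)
      ≡⟨ cong (∑[ v < P ] g v +_) (sumBelow-+ (suc (Q ∸ P)) (n ∸ Q) (g ∘ (P +_))) ⟩
    ∑[ v < P ] g v + (∑[ i < suc (Q ∸ P) ] g (P + i) + ∑[ j < n ∸ Q ] g (P + (suc (Q ∸ P) + j)))
      ≡⟨ cong (λ s → ∑[ v < P ] g v + (∑[ i < suc (Q ∸ P) ] g (P + i) + s))
              (sumBelow-cong (n ∸ Q) (λ {j} _ → cong g (shift j))) ⟩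
    ∑[ v < P ] g v + (∑[ i < suc (Q ∸ P) ] g (P + i) + ∑[ j < n ∸ Q ] g (suc Q + j)) ∎
    where
    open ≡-Reasoning
    P+1+[Q∸P]≡1+Q : P + suc (Q ∸ P) ≡ suc Q
    P+1+[Q∸P]≡1+Q = trans (+-suc P (Q ∸ P)) (cong suc P+[Q∸P]≡Q)
    shift : ∀ j → P + (suc (Q ∸ P) + j) ≡ suc Q + j
    shift j = trans (sym (+-assoc P (suc (Q ∸ P)) j)) (cong (_+ j) P+1+[Q∸P]≡1+Q)
    total : P + (suc (Q ∸ P) + (n ∸ Q)) ≡ suc n
    total = trans (shift (n ∸ Q)) (cong suc (m+[n∸m]≡n Q≤n))

  sumBelow-Outside : ∀ g → (∀ {v} → Inside v → g v ≡ 0) →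
    ∑[ v < suc n ] g v ≡ ∑[ v < P ] g v + ∑[ j < n ∸ Q ] g (suc Q + j)
  sumBelow-Outside g g-in = trans (sumBelow-split g)
    (cong (λ s → ∑[ v < P ] g v + (s + ∑[ j < n ∸ Q ] g (suc Q + j))) (sumBelow-zero (suc (Q ∸ P)) (g-in ∘ Inside-P+)))

  sumBelow-Inside : ∀ g → (∀ {v} → Outside v → g v ≡ 0) → ∑[ v < suc n ] g v ≡ ∑[ i < suc (Q ∸ P) ] g (P + i)
  sumBelow-Inside g g-out = trans (sumBelow-split g) (trans
    (cong₂ (λ s t → s + (∑[ i < suc (Q ∸ P) ] g (P + i) + t))
      (sumBelow-zero P (g-out ∘ inj₁)) (sumBelow-zero (n ∸ Q) (λ {j} _ → g-out (inj₂ (s≤s (m≤m+n Q j))))))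
    (+-identityʳ _))

  outsideCrossings insideCrossings : ℕ → ℕ
  outsideCrossings v = if inside P Q v then 0 else crossings v
  insideCrossings  v = if inside P Q v then crossings v else 0

  outsideCrossings-Outside : ∀ {v} → Outside v → outsideCrossings v ≡ crossings v
  outsideCrossings-Outside ov rewrite inside-Outside ov = refl

  outsideCrossings-Inside : ∀ {v} → Inside v → outsideCrossings v ≡ 0
  outsideCrossings-Inside iv rewrite inside-Inside iv = refl

  insideCrossings-Outside : ∀ {v} → Outside v → insideCrossings v ≡ 0
  insideCrossings-Outside ov rewrite inside-Outside ov = refl

  insideCrossings-Inside : ∀ {v} → Inside v → insideCrossings v ≡ crossings v
  insideCrossings-Inside iv rewrite inside-Inside iv = refl

  length-outerEnds : length outerEnds ≡ ∑[ v < suc n ] outsideCrossings v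
  length-outerEnds = begin
    length outerEnds                                              ≡⟨ length-replicateEach crossings outerList ⟩
    sum (map crossings outerList)                                 ≡⟨ cong sum (List.map-++ crossings (downFrom P) _) ⟩
    sum (map crossings (downFrom P) ++ map crossings (applyDownFrom (suc Q +_) (n ∸ Q)))
                                                                  ≡⟨ sum-++ (map crossings (downFrom P)) _ ⟩
    sum (map crossings (downFrom P)) + sum (map crossings (applyDownFrom (suc Q +_) (n ∸ Q)))
      ≡⟨ cong₂ _+_ (sum-map-applyDownFrom P crossings id) (sum-map-applyDownFrom (n ∸ Q) crossings (suc Q +_)) ⟩
    ∑[ v < P ] crossings v + ∑[ j < n ∸ Q ] crossings (suc Q + j)
      ≡⟨ cong₂ _+_ (sumBelow-cong P (λ v<P → outsideCrossings-Outside (inj₁ v<P)))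
                   (sumBelow-cong (n ∸ Q) (λ {j} _ → outsideCrossings-Outside (inj₂ (s≤s (m≤m+n Q j))))) ⟨
    ∑[ v < P ] outsideCrossings v + ∑[ j < n ∸ Q ] outsideCrossings (suc Q + j)
      ≡⟨ sumBelow-Outside outsideCrossings outsideCrossings-Inside ⟨
    ∑[ v < suc n ] outsideCrossings v                             ∎
    where open ≡-Reasoning

  length-innerEnds : length innerEnds ≡ ∑[ v < suc n ] insideCrossings v
  length-innerEnds = begin
    length innerEnds                                  ≡⟨ List.length-map ρ′ (replicateEach crossings innerList) ⟩
    length (replicateEach crossings innerList)        ≡⟨ length-replicateEach crossings innerList ⟩
    sum (map crossings innerList)                     ≡⟨ sum-map-applyDownFrom (suc (Q ∸ P)) crossings (P +_) ⟩
    ∑[ i < suc (Q ∸ P) ] crossings (P + i)            ≡⟨ sumBelow-cong (suc (Q ∸ P)) (insideCrossings-Inside ∘ Inside-P+) ⟨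
    ∑[ i < suc (Q ∸ P) ] insideCrossings (P + i)      ≡⟨ sumBelow-Inside insideCrossings insideCrossings-Outside ⟨
    ∑[ v < suc n ] insideCrossings v                  ∎
    where open ≡-Reasoning

  ∑outsideCrossings≡∑insideCrossings : ∑[ v < suc n ] outsideCrossings v ≡ ∑[ v < suc n ] insideCrossings v
  ∑outsideCrossings≡∑insideCrossings = begin
    ∑[ v < suc n ] outsideCrossings v
      ≡⟨ sumBelow-cong (suc n) (λ {v} _ → cong (if inside P Q v then 0 else_) (crossings-∑ v)) ⟩
    ∑[ v < suc n ] (if inside P Q v then 0 else crossDegree (inside P Q) (mult x) (suc n) v)
      ≡⟨ handshake (inside P Q) (mult x) (suc n) (mult-comm x) ⟩
    ∑[ v < suc n ] (if inside P Q v then crossDegree (inside P Q) (mult x) (suc n) v else 0)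
      ≡⟨ sumBelow-cong (suc n) (λ {v} _ → cong (λ c → if inside P Q v then c else 0) (crossings-∑ v)) ⟨
    ∑[ v < suc n ] insideCrossings v
      ∎
    where open ≡-Reasoning

  length-outerEnds≡length-innerEnds : length outerEnds ≡ length innerEnds
  length-outerEnds≡length-innerEnds =
    trans length-outerEnds (trans ∑outsideCrossings≡∑insideCrossings (sym length-innerEnds))

  count-p′ : count p′ outerEnds ≡ crossings p′
  count-p′ = let _ , eq , ≢p′ = outerEnds-prefix in trans (cong (count p′) eq) (count-replicate-++ p′ _ ≢p′)

  count-next : ∀ {r} → Next r → count r outerEnds ≡ crossings r
  count-next nx = let _ , eq , ≢r = outerEnds-suffix nx in trans (cong (count _) eq) (count-++-replicate _ _ ≢r)

  count-P : count P innerEnds ≡ crossings Q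
  count-P = let _ , eq , ≢P = innerEnds-prefix in trans (cong (count P) eq) (count-replicate-++ P _ ≢P)

  count-Q : count Q innerEnds ≡ crossings P
  count-Q = let _ , eq , ≢Q = innerEnds-suffix in trans (cong (count Q) eq) (count-++-replicate Q _ ≢Q)

  crossings-⊓≤rejoined-p′ : crossings p′ ⊓ crossings Q ≤ countPair p′ P rejoined
  crossings-⊓≤rejoined-p′ =
    let rest₁ , eq₁ , _ = outerEnds-prefix
        rest₂ , eq₂ , _ = innerEnds-prefix
    in subst (crossings p′ ⊓ crossings Q ≤_) (cong (countPair p′ P) (sym (cong₂ zip eq₁ eq₂)))
         (countPair-zip-replicate-++ p′ P _ _ rest₁ rest₂)

  crossings-⊓≤rejoined-Q : ∀ {r} → Next r → crossings r ⊓ crossings P ≤ countPair r Q rejoined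
  crossings-⊓≤rejoined-Q {r} nx =
    let front₁ , eq₁ , _ = outerEnds-suffix nx
        front₂ , eq₂ , _ = innerEnds-suffix
        length-front : length front₁ + crossings r ≡ length front₂ + crossings P
        length-front = begin
          length front₁ + crossings r                         ≡⟨ cong (length front₁ +_) (List.length-replicate (crossings r)) ⟨
          length front₁ + length (replicate (crossings r) r)  ≡⟨ List.length-++ front₁ ⟨
          length (front₁ ++ replicate (crossings r) r)        ≡⟨ cong length eq₁ ⟨
          length outerEnds                                    ≡⟨ length-outerEnds≡length-innerEnds ⟩
          length innerEnds                                    ≡⟨ cong length eq₂ ⟩
          length (front₂ ++ replicate (crossings P) Q)        ≡⟨ List.length-++ front₂ ⟩
          length front₂ + length (replicate (crossings P) Q)  ≡⟨ cong (length front₂ +_) (List.length-replicate (crossings P)) ⟩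
          length front₂ + crossings P                         ∎
    in subst (crossings r ⊓ crossings P ≤_) (cong (countPair r Q) (sym (cong₂ zip eq₁ eq₂)))
         (countPair-zip-++-replicate r Q _ _ front₁ front₂ length-front)
    where open ≡-Reasoning

  mult-p′P≤crossings-p′ : mult x p′ P ≤ crossings p′
  mult-p′P≤crossings-p′ = subst (_≤ crossings p′) (mult-comm x P p′)
    (mult≤crossings (≤-trans P≤Q Q≤n) (crossingTerm-in-out Inside-P Outside-p′))

  mult-p′P≤crossings-P : mult x p′ P ≤ crossings P
  mult-p′P≤crossings-P = mult≤crossings (<⇒≤ p′<n) (crossingTerm-out-in Outside-p′ Inside-P)

  mult-Qr≤crossings-Q : ∀ {r} → Next r → mult x Q r ≤ crossings Q
  mult-Qr≤crossings-Q {r} nx = subst (_≤ crossings Q) (mult-comm x r Q)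
    (mult≤crossings (Next-≤ nx) (crossingTerm-out-in (Next-Outside nx) Inside-Q))

  mult-Qr≤crossings-r : ∀ {r} → Next r → mult x Q r ≤ crossings r
  mult-Qr≤crossings-r nx = mult≤crossings Q≤n (crossingTerm-in-out Inside-Q (Next-Outside nx))

  chordEnds-lower : ∀ {r} → Next r → border x p′ ⊓ border x Q ≤ border y p′ ⊓ border y Q
  chordEnds-lower {r} nx = subst₂ _≤_
    (sym (cong₂ _⊓_ (border-< x p′<n) (border-Q x nx)))
    (sym (cong₂ _⊓_ y-border-p′ (y-border-Q nx)))
    (⊓-glb
      (≤-trans (⊓-mono-≤ mult-p′P≤crossings-p′ (mult-Qr≤crossings-Q nx)) crossings-⊓≤rejoined-p′)
      (≤-trans (⊓-glb (≤-trans (m⊓n≤n _ _) (mult-Qr≤crossings-r nx)) (≤-trans (m⊓n≤m _ _) mult-p′P≤crossings-P))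
               (crossings-⊓≤rejoined-Q nx)))

  P-separates : ∀ {u w} → u ≤ n → Outside u → Inside w → u ≢ p′ → w ≢ P → Interleaved p′ w P u
  P-separates {u} {w} _ ou (P≤w , w≤Q) u≢p′ w≢P = inj₁ (inj₁ (≤-refl , P<w) , beyond ou)
    where
    P<w : P < w
    P<w = ≤∧≢⇒< P≤w (w≢P ∘ sym)
    beyond : Outside u → Beyond p′ w u
    beyond (inj₁ u<P) = let u<p′ = ≤∧≢⇒< (s≤s⁻¹ u<P) u≢p′ in inj₁ (u<p′ , <-trans u<P P<w)
    beyond (inj₂ Q<u) = inj₂ (<-≤-trans ≤-refl (≤-trans P≤Q (<⇒≤ Q<u)) , ≤-<-trans w≤Q Q<u)

  Q-separates : ∀ {r} → Next r → ∀ {u w} → u ≤ n → Outside u → Inside w → u ≢ r → w ≢ Q → Interleaved r w Q u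
  Q-separates (next-suc Q<n) {u} {w} _ ou (P≤w , w≤Q) u≢r w≢Q = inj₁ (inj₂ (w<Q , ≤-refl) , beyond ou)
    where
    w<Q : w < Q
    w<Q = ≤∧≢⇒< w≤Q w≢Q
    beyond : Outside u → Beyond (suc Q) w u
    beyond (inj₁ u<P) = inj₁ (<-trans (<-≤-trans u<P P≤Q) ≤-refl , <-≤-trans u<P P≤w)
    beyond (inj₂ Q<u) = let 1+Q<u = ≤∧≢⇒< Q<u (u≢r ∘ sym) in inj₂ (1+Q<u , <-trans w<Q (<-trans ≤-refl 1+Q<u))
  Q-separates (next-wrap Q≡n) {u} {w} u≤n ou (P≤w , w≤Q) u≢r w≢Q =
    inj₂ (inj₁ (n≢0⇒n>0 u≢r , u<w ou) , inj₂ (z<s , ≤∧≢⇒< w≤Q w≢Q))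
    where
    u<w : Outside u → u < w
    u<w (inj₁ u<P) = <-≤-trans u<P P≤w
    u<w (inj₂ Q<u) = ⊥-elim (<⇒≱ Q<u (subst (u ≤_) (sym Q≡n) u≤n))

  data BorderPair (v : ℕ) : Set where
    outer-pair : v < n → Outside v → Outside (suc v) → BorderPair v
    inner-pair : Inside v → Inside (suc v) → BorderPair v
    wrap-pair  : v ≡ n → Q < n → BorderPair v

  borderPair : ∀ {v} → v ≤ n → v ≢ p′ → v ≢ Q → BorderPair v
  borderPair {v} v≤n v≢p′ v≢Q with <-cmp (suc v) P
  ... | tri< 1+v<P _ _ = outer-pair (<-trans ≤-refl (<-≤-trans 1+v<P (≤-trans P≤Q Q≤n))) (inj₁ (<-trans ≤-refl 1+v<P)) (inj₁ 1+v<P)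
  ... | tri≈ _ 1+v≡P _ = ⊥-elim (v≢p′ (suc-injective 1+v≡P))
  ... | tri> _ _ P<1+v with <-cmp v Q
  ...   | tri< v<Q _ _ = inner-pair (s≤s⁻¹ P<1+v , <⇒≤ v<Q) (<⇒≤ P<1+v , v<Q)
  ...   | tri≈ _ v≡Q _ = ⊥-elim (v≢Q v≡Q)
  ...   | tri> _ _ Q<v with m≤n⇒m<n∨m≡n v≤n
  ...     | inj₁ v<n = outer-pair v<n (inj₂ Q<v) (inj₂ (m<n⇒m<1+n Q<v))
  ...     | inj₂ v≡n = wrap-pair v≡n (<-≤-trans Q<v (≤-reflexive v≡n))

  y-border-outer : ∀ {v} → v < n → Outside v → Outside (suc v) → border y v ≡ border x v
  y-border-outer {v} v<n ov osv =
    trans (border-< y v<n) (trans (mult-< y {v} ≤-refl) (trans (arcs-y-outer ov osv ≤-refl) (sym (border-< x v<n))))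

  y-border-inner : ∀ {v} → Inside v → Inside (suc v) → border y v ≡ border x (ρ′ (suc v))
  y-border-inner {v} iv isv = begin
    border y v                             ≡⟨ border-< y (<-≤-trans ≤-refl (≤-trans (proj₂ isv) Q≤n)) ⟩
    mult y v (suc v)                       ≡⟨ mult-< y {v} ≤-refl ⟩
    arcs y v (suc v)                       ≡⟨ arcs-y-inner iv isv ≤-refl ⟩
    mult x (ρ′ v) (ρ′ (suc v))             ≡⟨ cong (λ a → mult x a (ρ′ (suc v))) (ρ-suc iv isv) ⟩
    mult x (suc (ρ′ (suc v))) (ρ′ (suc v)) ≡⟨ mult-comm x _ _ ⟩
    mult x (ρ′ (suc v)) (suc (ρ′ (suc v))) ≡⟨ border-< x w<n ⟨
    border x (ρ′ (suc v))                  ∎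
    where
    open ≡-Reasoning
    w<n : ρ′ (suc v) < n
    w<n = ≤-trans (≤-reflexive (sym (ρ-suc iv isv))) (≤-trans (proj₂ (ρ-preserves-Inside iv)) Q≤n)

  y-border-wrap : Q < n → border y n ≡ border x n
  y-border-wrap Q<n = begin
    border y n   ≡⟨ border-n y ⟩
    mult y n 0   ≡⟨ mult-> y 0<n ⟩
    arcs y 0 n   ≡⟨ arcs-y-outer (inj₁ z<s) (inj₂ Q<n) 0<n ⟩
    mult x 0 n   ≡⟨ mult-comm x 0 n ⟩
    mult x n 0   ≡⟨ border-n x ⟨
    border x n   ∎
    where
    open ≡-Reasoning
    0<n : 0 < n
    0<n = <-≤-trans z<s Q≤n

  y-border-elsewhere : ∀ {v} → v ≤ n → v ≢ p′ → v ≢ Q → ∃ λ u → u ≤ n × border y v ≡ border x u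
  y-border-elsewhere v≤n v≢p′ v≢Q with borderPair v≤n v≢p′ v≢Q
  ... | outer-pair v<n ov osv = _ , v≤n , y-border-outer v<n ov osv
  ... | inner-pair iv isv     = _ , ≤-trans (proj₂ (ρ-preserves-Inside isv)) Q≤n , y-border-inner iv isv
  ... | wrap-pair refl Q<n    = _ , v≤n , y-border-wrap Q<n

  x-border-elsewhere : ∀ {v} → v ≤ n → v ≢ p′ → v ≢ Q → ∃ λ u → u ≤ n × border x v ≡ border y u
  x-border-elsewhere v≤n v≢p′ v≢Q with borderPair v≤n v≢p′ v≢Q
  ... | outer-pair v<n ov osv = _ , v≤n , sym (y-border-outer v<n ov osv)
  ... | inner-pair iv isv     =
    let iw  = ρ-preserves-Inside isv
        isw = subst Inside (ρ-suc iv isv) (ρ-preserves-Inside iv)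
    in _ , ≤-trans (proj₂ iw) Q≤n ,
       sym (trans (y-border-inner iw isw) (cong (border x) (trans (cong ρ′ (sym (ρ-suc iv isv))) (ρ-involutive iv))))
  ... | wrap-pair refl Q<n    = _ , v≤n , sym (y-border-wrap Q<n)

  module _ (nc : NonCrossing x) where

    adjacent-dichotomy : ∀ {o i} → Outside o → Inside i →
      (∀ {u w} → u ≤ n → Outside u → Inside w → u ≢ o → w ≢ i → Interleaved o w i u) →
      crossings i ≤ mult x o i ⊎ crossings o ≤ mult x o i
    adjacent-dichotomy {o} {i} oo ii separated = Sum.map bound-i bound-o (all⊎all A? B? (suc n) ¬both)
      where
      A B : ℕ → Set
      A u = crossingTerm i u ≡ 0 ⊎ u ≡ o
      B w = crossingTerm o w ≡ 0 ⊎ w ≡ i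
      A? : Decidable A
      A? u = (crossingTerm i u ≟ 0) ⊎-dec (u ≟ o)
      B? : Decidable B
      B? w = (crossingTerm o w ≟ 0) ⊎-dec (w ≟ i)
      ¬both : ∀ {u w} → u < suc n → w < suc n → ¬ A u → ¬ B w → ⊥
      ¬both u<1+n _ ¬Au ¬Bw =
        let ou , ui>0 = crossingTerm-Inside ii (¬Au ∘ inj₁)
            iw , wo>0 = crossingTerm-Outside oo (¬Bw ∘ inj₁)
        in ¬interleaved x nc (mult-pos-comm x wo>0) (mult-pos-comm x ui>0)
             (separated (s≤s⁻¹ u<1+n) ou iw (¬Au ∘ inj₂) (¬Bw ∘ inj₂))
      bound-i : (∀ {u} → u < suc n → A u) → crossings i ≤ mult x o i
      bound-i allA = subst₂ _≤_ (sym (crossings-∑ i)) (crossingTerm-out-in oo ii)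
        (sumBelow≤single (suc n) (crossingTerm i) o allA)
      bound-o : (∀ {w} → w < suc n → B w) → crossings o ≤ mult x o i
      bound-o allB = subst₂ _≤_ (sym (crossings-∑ o)) (trans (crossingTerm-in-out ii oo) (mult-comm x i o))
        (sumBelow≤single (suc n) (crossingTerm o) i allB)

    chordEnds-upper : ∀ {r} → Next r → border y p′ ⊓ border y Q ≤ border x p′ ⊓ border x Q
    chordEnds-upper {r} nx = subst₂ _≤_
      (sym (cong₂ _⊓_ y-border-p′ (y-border-Q nx)))
      (sym (cong₂ _⊓_ (border-< x p′<n) (border-Q x nx)))
      (⊓-glb ≤mult-p′P ≤mult-Qr)
      where
      new-p′ = countPair p′ P rejoined
      new-Q = countPair r Q rejoined
      ≤mult-p′P : new-p′ ⊓ new-Q ≤ mult x p′ P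
      ≤mult-p′P with adjacent-dichotomy Outside-p′ Inside-P P-separates
      ... | inj₁ crossings-P≤ = ≤-trans (m⊓n≤n new-p′ new-Q)
        (≤-trans (countPair-zip≤countʳ r Q outerEnds innerEnds) (subst (_≤ _) (sym count-Q) crossings-P≤))
      ... | inj₂ crossings-p′≤ = ≤-trans (m⊓n≤m new-p′ new-Q)
        (≤-trans (countPair-zip≤countˡ p′ P outerEnds innerEnds) (subst (_≤ _) (sym count-p′) crossings-p′≤))
      ≤mult-Qr : new-p′ ⊓ new-Q ≤ mult x Q r
      ≤mult-Qr with adjacent-dichotomy (Next-Outside nx) Inside-Q (Q-separates nx)
      ... | inj₁ crossings-Q≤ = ≤-trans (m⊓n≤m new-p′ new-Q)
        (≤-trans (countPair-zip≤countʳ p′ P outerEnds innerEnds) (subst₂ _≤_ (sym count-P) (mult-comm x r Q) crossings-Q≤))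
      ... | inj₂ crossings-r≤ = ≤-trans (m⊓n≤n new-p′ new-Q)
        (≤-trans (countPair-zip≤countˡ r Q outerEnds innerEnds) (subst₂ _≤_ (sym (count-next nx)) (mult-comm x r Q) crossings-r≤))

    borderThickness-y : borderThickness y ≡ borderThickness x
    borderThickness-y = let _ , nx = next in ≤-antisym
      (borderThickness-≤ y x (<⇒≤ p′<n) Q≤n (chordEnds-upper nx) x-border-elsewhere)
      (borderThickness-≤ x y (<⇒≤ p′<n) Q≤n (chordEnds-lower nx) y-border-elsewhere)

act-preserves : ∀ {n} (x : RawDiagram n) → NonCrossing x → ∀ w →
  NonCrossing (act w x) × borderThickness (act w x) ≡ borderThickness x
act-preserves x nc []                  = nc , refl
act-preserves x nc ((p , q , p<q) ∷ w) =
  let nc′ , thickness≡ = act-preserves x nc w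
      open Generator p q p<q (act w x)
  in y-NonCrossing nc′ , trans (borderThickness-y nc′) thickness≡

lemma4p1 : (n : ℕ) → 2 ≤ n → (l : Fin n → ℕ) (l∞ : ℕ) (x : RawDiagram n) →
    InX n l l∞ x → (g : Word n) → borderThickness (act g x) ≡ borderThickness x
lemma4p1 n _ l l∞ x x∈X g = proj₂ (act-preserves x (InX.noncrossing x∈X) g)
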